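{- For every integer $r\geqslant1$, $$\delta\Big(\sum_{\mathbf{a}\in\mathcal{A}_{2r}}(-1)^{\mathrm{depth}(\mathbf{a})}\,4^{\mathrm{height}(\mathbf{a})-1}\,[\mathbf{a}]\Big)=(-1)^r3^{2r-1}(\underbrace{2,\ldots,2}_r).$$
   Context: A composition is a finite sequence $\mathbf{a}=(a_1,\ldots,a_r)$ of positive integers ($r\geqslant0$), of depth $r$ and weight $\sum a_i$; its height is the number of its entries that are $\geqslant2$. It is admissible if $r=0$ or $a_1\geqslant2$. $\mathcal{A}$ (resp. $\mathcal{A}_k$) is the set of admissible compositions (resp. of weight $k$). Binary word $\mathbf{w}(\mathbf{a})=0^{a_1-1}1\cdots0^{a_r-1}1$; the dual of a word $\varepsilon_1\cdots\varepsilon_k$ is $\overline{\varepsilon_k}\cdots\overline{\varepsilon_1}$ ($\overline0=1,\overline1=0$); $\overline{\mathbf{a}}$ is the admissible composition with word dual to $\mathbf{w}(\mathbf{a})$. $\mathcal{B}=\mathcal{A}/(\mathbf{a}\sim\overline{\mathbf{a}})$, classes $[\mathbf{a}]$, $\mathcal{B}_k$ classes of weight $k$; $\mathbf{Z}^{(X)}$ is the free $\mathbf{Z}$-module on $X$. $(a_1,\ldots,a_r)^{\rm init}=(a_1,\ldots,a_{r-1})$ ($\varnothing^{\rm init}=\varnothing$); for admissible $\mathbf{a}$, $\mathbf{a}^{\rm fin}$ is the dual of $(\overline{\mathbf{a}})^{\rm init}$ and $\mathbf{a}^{\rm mid}=(\mathbf{a}^{\rm fin})^{\rm init}$; extended $\mathbf{Z}$-linearly.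 $\delta$ is the unique $\mathbf{Z}$-linear map $\mathbf{Z}^{(\mathcal{B})}\to\mathbf{Z}^{(\mathcal{A})}$ with $\delta(\mathbf{Z}^{\mathcal{B}_k})\subset\mathbf{Z}^{\mathcal{A}_k}$ for all $k$, $\delta([\varnothing])=\varnothing$, and $\delta([\mathbf{a}])^{\rm init}=\delta([\mathbf{a}^{\rm init}])+\delta([\mathbf{a}^{\rm mid}])+\delta([\mathbf{a}^{\rm fin}])$ for all non-empty admissible $\mathbf{a}$. -}

module Defs where

open import Data.Bool using (Bool; true; false; not; if_then_else_)
open import Data.Nat as ℕ using (ℕ; zero; suc; _≤_; _∸_; _≤ᵇ_)
import Data.Nat.Properties as ℕP
open import Data.Integer as ℤ using (ℤ; +_; -_)
open import Data.List using (List; []; _∷_; _++_; map; reverse; replicate; concat; concatMap; filter; length)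
open import Data.Nat.ListAction using (sum)
open import Data.List.Properties using (≡-dec)
open import Data.List.Relation.Unary.All using (All)
open import Data.Product using (_×_; _,_)
open import Relation.Nullary using (does; ¬_)
open import Relation.Binary.PropositionalEquality using (_≡_)

-- Compositions: finite lists of natural numbers (entries must be ≥ 1,
-- see IsComposition).  The entries are the actual integers a_i.

Composition : Set
Composition = List ℕ

IsComposition : Composition → Set
IsComposition a = All (1 ≤_) a

depth : Composition → ℕ
depth = length

weight : Composition → ℕ
weight = sum

height : Composition → ℕ
height [] = 0
height (x ∷ xs) = (if 2 ≤ᵇ x then 1 else 0) ℕ.+ height xs

admHead : Composition → Bool
admHead [] = true
admHead (x ∷ _) = 2 ≤ᵇ x

Admissible : Composition → Set
Admissible a = IsComposition a × (admHead a ≡ true)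

-- Binary words and duality (false = 0, true = 1)

word : Composition → List Bool
word [] = []
word (x ∷ xs) = replicate (x ∸ 1) false ++ (true ∷ word xs)

-- read a word 0^{a₁-1}1 ⋯ 0^{a_r-1}1 back as a composition
-- (n counts the zeros read so far)
fromWord′ : ℕ → List Bool → Composition
fromWord′ n [] = []
fromWord′ n (false ∷ w) = fromWord′ (suc n) w
fromWord′ n (true ∷ w) = suc n ∷ fromWord′ 0 w

fromWord : List Bool → Composition
fromWord = fromWord′ 0

dualWord : List Bool → List Bool
dualWord w = map not (reverse w)

dual : Composition → Composition
dual a = fromWord (dualWord (word a))

init : Composition → Composition
init [] = []
init (x ∷ []) = []
init (x ∷ y ∷ xs) = x ∷ init (y ∷ xs)

fin : Composition → Composition
fin a = dual (init (dual a))

mid : Composition → Composition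
mid a = init (fin a)

-- The free ℤ-module ℤ^(𝒜): formal finite sums Σ cᵢ · aᵢ, compared
-- through their coefficient functions.

FormalSum : Set
FormalSum = List (ℤ × Composition)

coeff : FormalSum → Composition → ℤ
coeff [] b = + 0
coeff ((c , a) ∷ s) b =
  (if does (≡-dec ℕ._≟_ a b) then c else + 0) ℤ.+ coeff s b

_≈_ : FormalSum → FormalSum → Set
s ≈ t = ∀ b → coeff s b ≡ coeff t b

infix 4 _≈_

single : Composition → FormalSum
single a = (+ 1 , a) ∷ []

_⊕_ : FormalSum → FormalSum → FormalSum
s ⊕ t = s ++ t

infixl 6 _⊕_

_⊙_ : ℤ → FormalSum → FormalSum
c ⊙ s = map (λ { (d , a) → (c ℤ.* d , a) }) s

infixl 7 _⊙_

initL : FormalSum → FormalSum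
initL s = map (λ { (c , a) → (c , init a) }) s

words : ℕ → List (List Bool)
words zero = [] ∷ []
words (suc n) = concatMap (λ w → (false ∷ w) ∷ (true ∷ w) ∷ []) (words n)

-- all compositions of weight k (bijection with words of length k ending in 1)
compositionsOfWeight : ℕ → List Composition
compositionsOfWeight zero = [] ∷ []
compositionsOfWeight (suc k) = map (λ w → fromWord (w ++ (true ∷ []))) (words k)

admissibleOfWeight : ℕ → List Composition
admissibleOfWeight k = filter (λ a → Data.Bool._≟_ (admHead a) true) (compositionsOfWeight k)
  where import Data.Bool

-- An element of ℤ^(ℬ) is represented by a formal sum
-- of representatives; δ is given by its values on representatives
-- D : Composition → FormalSum, and must be constant on classes [a] = [ā].

¬₀ : ℤ → Set
¬₀ z = ¬ (z ≡ + 0)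

record IsDelta (D : Composition → FormalSum) : Set where
  field
    -- well defined on ℬ = 𝒜/(a ∼ ā)
    classInv : ∀ a → Admissible a → D a ≈ D (dual a)
    homog    : ∀ a b → Admissible a → ¬₀ (coeff (D a) b) →
               Admissible b × (weight b ≡ weight a)
    empty    : D [] ≈ single []
    rec      : ∀ x xs → Admissible (x ∷ xs) →
               initL (D (x ∷ xs)) ≈ D (init (x ∷ xs)) ⊕ D (mid (x ∷ xs)) ⊕ D (fin (x ∷ xs))

linExt : (Composition → FormalSum) → FormalSum → FormalSum
linExt D [] = []
linExt D ((c , a) ∷ s) = c ⊙ D a ⊕ linExt D s

theSum : ℕ → FormalSum
theSum r = map (λ a → ((- + 1) ℤ.^ depth a ℤ.* (+ 4) ℤ.^ (height a ∸ 1) , a))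
               (admissibleOfWeight (2 ℕ.* r))

-- Let c(a) = (-1)^depth(a) 4^(height(a)-1), so that the left side is δ(S_r) with
-- S_r = Σ_{a ∈ 𝒜_2r} c(a) [a]. Both sides are supported in 𝒜_2r, where a is determined by
-- a^init, so it suffices to compare their images under init; by the recursion defining δ,
-- δ(S_r)^init = Σ c(a) (δ[a^init] + δ[a^mid] + δ[a^fin]). Pairing with the coefficient ψ of a
-- fixed composition in δ, which is constant on classes and supported in a single weight, turns
-- this into Σ_y ψ(y) P(y), where P(y) is the c-weighted number of a ∈ 𝒜_2r with a^init, a^mid
-- or a^fin equal to y. Reindexing by a ↦ ā (c(ā) = c(a) in even weight) expresses a^mid and
-- a^fin through a^init, and removing the last one or two entries of a gives, for r ≥ 2,
-- P(y) + P(ȳ) = -9 (c(y) + c(ȳ)) [weight y = 2r - 2]. Since ψ(y) = ψ(ȳ), this shows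
-- δ(S_r)^init = -9 δ(S_(r-1)), and the claim follows by induction from δ(S_1)^init = -3 ∅.

module Submission where

open import Defs
open import Data.Bool as Bool using (Bool; true; false; not; if_then_else_; _∧_)
open import Data.Bool.Properties using (not-involutive; ∧-comm)
open import Data.Nat as ℕ using (ℕ; zero; suc; _∸_; _≤_; _<_; z≤n; s≤s)
import Data.Nat.Properties as ℕP
open import Data.Integer as ℤ using (ℤ; +_; -_; _+_; _*_; _-_; _^_; 0ℤ; 1ℤ; -1ℤ)
import Data.Integer.Properties as ℤP
open import Data.Integer.Tactic.RingSolver using (solve-∀)
import Data.Nat.Tactic.RingSolver as ℕSolver
open import Data.List
  using (List; []; _∷_; _++_; _∷ʳ_; initLast; _∷ʳ′_; map; reverse; replicate; concatMap; length; downFrom; deduplicate)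
import Data.List.Properties as ListP
open import Data.List.Properties using (≡-dec)
open import Data.List.Membership.Propositional using (_∈_; _∉_; find)
open import Data.List.Membership.Propositional.Properties
  using (∈-map⁺; ∈-map⁻; ∈-filter⁺; ∈-filter⁻; ∈-concatMap⁺; ∈-concatMap⁻; ∈-downFrom⁺; ∈-downFrom⁻; ∈-deduplicate⁺)
open import Data.List.Relation.Unary.Any as Any using (here; there)
open import Data.List.Relation.Unary.All as All using (All; []; _∷_)
import Data.List.Relation.Unary.All.Properties as AllP
open import Data.List.Relation.Unary.Unique.Propositional using (Unique; []; _∷_)
import Data.List.Relation.Unary.Unique.Propositional.Properties as Unique
open import Data.List.Relation.Unary.Unique.DecPropositional.Properties using (deduplicate-!)
open import Data.Product using (_×_; _,_; proj₁; proj₂; ∃-syntax)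
open import Data.Sum using (_⊎_; inj₁; inj₂)
open import Data.Empty using (⊥-elim)
open import Function using (id; _∘_; _⇔_; mk⇔; Equivalence)
open import Relation.Binary.Definitions using (DecidableEquality)
open import Relation.Binary.PropositionalEquality
open import Relation.Nullary using (does; yes; no; ¬_; Dec)
open import Relation.Nullary.Decidable using (dec-true; dec-false)

private variable A B : Set

∑ : List A → (A → ℤ) → ℤ
∑ []       f = 0ℤ
∑ (x ∷ xs) f = f x + ∑ xs f

syntax ∑ xs (λ x → e) = ∑[ x ∈ xs ] e

∑-cong-∈ : ∀ xs {f g : A → ℤ} → (∀ {x} → x ∈ xs → f x ≡ g x) → ∑ xs f ≡ ∑ xs g
∑-cong-∈ []       eq = refl
∑-cong-∈ (x ∷ xs) eq = cong₂ _+_ (eq (here refl)) (∑-cong-∈ xs (eq ∘ there))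

∑-cong : ∀ xs {f g : A → ℤ} → (∀ x → f x ≡ g x) → ∑ xs f ≡ ∑ xs g
∑-cong xs eq = ∑-cong-∈ xs (λ {x} _ → eq x)

∑-++ : ∀ xs ys (f : A → ℤ) → ∑ (xs ++ ys) f ≡ ∑ xs f + ∑ ys f
∑-++ []       ys f = sym (ℤP.+-identityˡ _)
∑-++ (x ∷ xs) ys f = trans (cong (_+_ (f x)) (∑-++ xs ys f)) (sym (ℤP.+-assoc (f x) _ _))

∑-zero : (xs : List A) → ∑[ x ∈ xs ] 0ℤ ≡ 0ℤ
∑-zero []       = refl
∑-zero (x ∷ xs) = trans (ℤP.+-identityˡ _) (∑-zero xs)

∑-+ : ∀ xs (f g : A → ℤ) → ∑[ x ∈ xs ] (f x + g x) ≡ ∑ xs f + ∑ xs g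
∑-+ []       f g = refl
∑-+ (x ∷ xs) f g = trans (cong (_+_ (f x + g x)) (∑-+ xs f g)) (swap (f x) (g x) _ _)
  where
  swap : ∀ a b c d → (a + b) + (c + d) ≡ (a + c) + (b + d)
  swap = solve-∀

∑-*ˡ : ∀ xs c (f : A → ℤ) → ∑[ x ∈ xs ] (c * f x) ≡ c * ∑ xs f
∑-*ˡ []       c f = sym (ℤP.*-zeroʳ c)
∑-*ˡ (x ∷ xs) c f = trans (cong (_+_ (c * f x)) (∑-*ˡ xs c f)) (sym (ℤP.*-distribˡ-+ c (f x) _))

∑-*ʳ : ∀ xs (f : A → ℤ) c → ∑[ x ∈ xs ] (f x * c) ≡ ∑ xs f * c
∑-*ʳ xs f c = trans (∑-cong xs λ x → ℤP.*-comm (f x) c) (trans (∑-*ˡ xs c f) (ℤP.*-comm c _))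

∑-comm : (xs : List A) (ys : List B) (F : A → B → ℤ) →
         ∑[ x ∈ xs ] ∑[ y ∈ ys ] F x y ≡ ∑[ y ∈ ys ] ∑[ x ∈ xs ] F x y
∑-comm []       ys F = sym (∑-zero ys)
∑-comm (x ∷ xs) ys F =
  trans (cong (_+_ (∑ ys (F x))) (∑-comm xs ys F)) (sym (∑-+ ys (F x) (λ y → ∑[ x ∈ xs ] F x y)))

∑-map : (g : A → B) (xs : List A) (f : B → ℤ) → ∑ (map g xs) f ≡ ∑ xs (f ∘ g)
∑-map g []       f = refl
∑-map g (x ∷ xs) f = cong (_+_ (f (g x))) (∑-map g xs f)

∑≢0⇒∃ : ∀ xs (f : A → ℤ) → ∑ xs f ≢ 0ℤ → ∃[ x ] x ∈ xs × f x ≢ 0ℤ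
∑≢0⇒∃ []       f ∑≢0 = ⊥-elim (∑≢0 refl)
∑≢0⇒∃ (x ∷ xs) f ∑≢0 with f x ℤ.≟ 0ℤ
... | no  fx≢0 = x , here refl , fx≢0
... | yes fx≡0 with ∑≢0⇒∃ xs f (λ ∑≡0 → ∑≢0 (cong₂ _+_ fx≡0 ∑≡0))
...   | y , y∈xs , fy≢0 = y , there y∈xs , fy≢0

module Indicator {A : Set} (_≟_ : DecidableEquality A) where

  𝟙 : A → A → ℤ
  𝟙 x y = if does (x ≟ y) then 1ℤ else 0ℤ

  𝟙-≡ : ∀ {x y} → x ≡ y → 𝟙 x y ≡ 1ℤ
  𝟙-≡ {x} {y} x≡y rewrite dec-true (x ≟ y) x≡y = refl

  𝟙-≢ : ∀ {x y} → x ≢ y → 𝟙 x y ≡ 0ℤ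
  𝟙-≢ {x} {y} x≢y rewrite dec-false (x ≟ y) x≢y = refl

  𝟙-cong-⇔ : ∀ {x y u v} → x ≡ y ⇔ u ≡ v → 𝟙 x y ≡ 𝟙 u v
  𝟙-cong-⇔ {x} {y} x≡y⇔u≡v with x ≟ y
  ... | yes x≡y = sym (𝟙-≡ (Equivalence.to x≡y⇔u≡v x≡y))
  ... | no  x≢y = sym (𝟙-≢ (x≢y ∘ Equivalence.from x≡y⇔u≡v))

  𝟙-sym : ∀ x y → 𝟙 x y ≡ 𝟙 y x
  𝟙-sym x y = 𝟙-cong-⇔ (mk⇔ sym sym)

  ∑-𝟙-∉ : ∀ {x xs} (f : A → ℤ) → x ∉ xs → ∑[ y ∈ xs ] (𝟙 x y * f y) ≡ 0ℤ
  ∑-𝟙-∉ {x} {xs} f x∉xs = trans (∑-cong-∈ xs vanish) (∑-zero xs)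
    where
    vanish : ∀ {y} → y ∈ xs → 𝟙 x y * f y ≡ 0ℤ
    vanish {y} y∈xs = trans (cong (_* f y) (𝟙-≢ λ { refl → x∉xs y∈xs })) (ℤP.*-zeroˡ (f y))

  ∑-𝟙-∈ : ∀ {x xs} (f : A → ℤ) → Unique xs → x ∈ xs → ∑[ y ∈ xs ] (𝟙 x y * f y) ≡ f x
  ∑-𝟙-∈ f xs!@(_ ∷ _) (here refl) =
    trans (cong₂ _+_ (trans (cong (_* f _) (𝟙-≡ refl)) (ℤP.*-identityˡ _))
                     (∑-𝟙-∉ f (Unique.Unique[x∷xs]⇒x∉xs xs!)))
          (ℤP.+-identityʳ _)
  ∑-𝟙-∈ {xs = z ∷ _} f (z∉zs ∷ zs!) (there x∈zs) =
    trans (cong₂ _+_ (trans (cong (_* f z) (𝟙-≢ λ { refl → All.lookup z∉zs x∈zs refl })) (ℤP.*-zeroˡ (f z)))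
                     (∑-𝟙-∈ f zs! x∈zs))
          (ℤP.+-identityˡ _)

_≟ᶜ_ : DecidableEquality Composition
_≟ᶜ_ = ≡-dec ℕ._≟_

open Indicator _≟ᶜ_
module ℕ𝟙 = Indicator ℕ._≟_

⟨_,_⟩ : FormalSum → (Composition → ℤ) → ℤ
⟨ X , φ ⟩ = ∑ X (λ (c , a) → c * φ a)

coeff-⟨⟩ : ∀ X b → coeff X b ≡ ⟨ X , (λ a → 𝟙 a b) ⟩
coeff-⟨⟩ []            b = refl
coeff-⟨⟩ ((c , a) ∷ X) b = cong₂ _+_ (if-as-product (does (a ≟ᶜ b))) (coeff-⟨⟩ X b)
  where
  if-as-product : ∀ t → (if t then c else 0ℤ) ≡ c * (if t then 1ℤ else 0ℤ)
  if-as-product true  = sym (ℤP.*-identityʳ c)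
  if-as-product false = sym (ℤP.*-zeroʳ c)

⟨⟩-++ : ∀ X Y φ → ⟨ X ++ Y , φ ⟩ ≡ ⟨ X , φ ⟩ + ⟨ Y , φ ⟩
⟨⟩-++ X Y φ = ∑-++ X Y _

⟨⟩-⊙ : ∀ c X φ → ⟨ c ⊙ X , φ ⟩ ≡ c * ⟨ X , φ ⟩
⟨⟩-⊙ c X φ = trans (∑-map _ X _) (trans (∑-cong X λ (d , a) → ℤP.*-assoc c d (φ a)) (∑-*ˡ X c _))

⟨⟩-single : ∀ a φ → ⟨ single a , φ ⟩ ≡ φ a
⟨⟩-single a φ = trans (ℤP.+-identityʳ _) (ℤP.*-identityˡ (φ a))

⟨⟩-initL : ∀ X φ → ⟨ initL X , φ ⟩ ≡ ⟨ X , φ ∘ init ⟩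
⟨⟩-initL X φ = ∑-map _ X _

⟨⟩-linExt : ∀ D L φ → ⟨ linExt D L , φ ⟩ ≡ ⟨ L , (λ a → ⟨ D a , φ ⟩) ⟩
⟨⟩-linExt D []            φ = refl
⟨⟩-linExt D ((c , a) ∷ L) φ =
  trans (⟨⟩-++ (c ⊙ D a) (linExt D L) φ) (cong₂ _+_ (⟨⟩-⊙ c (D a) φ) (⟨⟩-linExt D L φ))

keys : FormalSum → List Composition
keys X = deduplicate _≟ᶜ_ (map proj₂ X)

⟨⟩-via-coeff : ∀ X φ → ⟨ X , φ ⟩ ≡ ∑[ b ∈ keys X ] (coeff X b * φ b)
⟨⟩-via-coeff X φ = begin
  ∑ X (λ (c , a) → c * φ a)
    ≡⟨ ∑-cong-∈ X (λ {(c , a)} p∈X → cong (c *_) (sym (∑-𝟙-∈ φ (deduplicate-! _≟ᶜ_ (map proj₂ X)) (a∈keys p∈X)))) ⟩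
  ∑ X (λ (c , a) → c * ∑[ b ∈ keys X ] (𝟙 a b * φ b))
    ≡⟨ ∑-cong X (λ (c , a) → trans (sym (∑-*ˡ (keys X) c _)) (∑-cong (keys X) λ b → sym (ℤP.*-assoc c (𝟙 a b) (φ b)))) ⟩
  ∑ X (λ (c , a) → ∑[ b ∈ keys X ] (c * 𝟙 a b * φ b))
    ≡⟨ ∑-comm X (keys X) _ ⟩
  ∑[ b ∈ keys X ] ∑ X (λ (c , a) → c * 𝟙 a b * φ b)
    ≡⟨ ∑-cong (keys X) (λ b → trans (∑-*ʳ X _ (φ b)) (cong (_* φ b) (sym (coeff-⟨⟩ X b)))) ⟩
  ∑[ b ∈ keys X ] (coeff X b * φ b) ∎
  where
  open ≡-Reasoning
  a∈keys : ∀ {c a} → (c , a) ∈ X → a ∈ keys X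
  a∈keys p∈X = ∈-deduplicate⁺ _≟ᶜ_ (∈-map⁺ proj₂ p∈X)

⟨⟩-cong-support : ∀ X {φ ψ} → (∀ b → coeff X b ≢ 0ℤ → φ b ≡ ψ b) → ⟨ X , φ ⟩ ≡ ⟨ X , ψ ⟩
⟨⟩-cong-support X {φ} {ψ} φ≡ψ =
  trans (⟨⟩-via-coeff X φ) (trans (∑-cong (keys X) termwise) (sym (⟨⟩-via-coeff X ψ)))
  where
  termwise : ∀ b → coeff X b * φ b ≡ coeff X b * ψ b
  termwise b with coeff X b ℤ.≟ 0ℤ
  ... | yes Xb≡0 = trans (cong (_* φ b) Xb≡0) (sym (cong (_* ψ b) Xb≡0))
  ... | no  Xb≢0 = cong (coeff X b *_) (φ≡ψ b Xb≢0)

coeff-++ : ∀ X Y b → coeff (X ++ Y) b ≡ coeff X b + coeff Y b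
coeff-++ X Y b = trans (coeff-⟨⟩ (X ++ Y) b) (trans (⟨⟩-++ X Y _) (sym (cong₂ _+_ (coeff-⟨⟩ X b) (coeff-⟨⟩ Y b))))

coeff-⊙-single : ∀ c a b → coeff (c ⊙ single a) b ≡ c * 𝟙 a b
coeff-⊙-single c a b = trans (coeff-⟨⟩ (c ⊙ single a) b) (trans (⟨⟩-⊙ c (single a) (λ x → 𝟙 x b)) (cong (c *_) (⟨⟩-single a (λ x → 𝟙 x b))))

coeff-initL : ∀ X b → coeff (initL X) b ≡ ⟨ X , (λ a → 𝟙 (init a) b) ⟩
coeff-initL X b = trans (coeff-⟨⟩ (initL X) b) (⟨⟩-initL X _)

coeff-linExt : ∀ D L b → coeff (linExt D L) b ≡ ⟨ L , (λ a → coeff (D a) b) ⟩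
coeff-linExt D L b =
  trans (coeff-⟨⟩ (linExt D L) b) (trans (⟨⟩-linExt D L _) (∑-cong L λ (c , a) → cong (c *_) (sym (coeff-⟨⟩ (D a) b))))

dualWord-∷ʳ : ∀ u b → dualWord (u ++ b ∷ []) ≡ not b ∷ dualWord u
dualWord-∷ʳ u b = cong (map not) (ListP.reverse-++ u (b ∷ []))

dualWord-∷ : ∀ b u → dualWord (b ∷ u) ≡ dualWord u ++ not b ∷ []
dualWord-∷ b u = trans (cong (map not) (ListP.unfold-reverse b u)) (ListP.map-++ not (reverse u) (b ∷ []))

dualWord-involutive : ∀ u → dualWord (dualWord u) ≡ u
dualWord-involutive []      = refl
dualWord-involutive (b ∷ u) =
  trans (cong dualWord (dualWord-∷ b u))
        (trans (dualWord-∷ʳ (dualWord u) (not b)) (cong₂ _∷_ (not-involutive b) (dualWord-involutive u)))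

length-dualWord : ∀ u → length (dualWord u) ≡ length u
length-dualWord u = trans (ListP.length-map not (reverse u)) (ListP.length-reverse u)

fromWord′-isComposition : ∀ n u → IsComposition (fromWord′ n u)
fromWord′-isComposition n []          = []
fromWord′-isComposition n (false ∷ u) = fromWord′-isComposition (suc n) u
fromWord′-isComposition n (true ∷ u)  = s≤s z≤n ∷ fromWord′-isComposition 0 u

admHead-fromWord′ : ∀ n u → admHead (fromWord′ (suc n) u) ≡ true
admHead-fromWord′ n []          = refl
admHead-fromWord′ n (false ∷ u) = admHead-fromWord′ (suc n) u
admHead-fromWord′ n (true ∷ u)  = refl

fromWord′-replicate : ∀ n m v → fromWord′ n (replicate m false ++ v) ≡ fromWord′ (n ℕ.+ m) v
fromWord′-replicate n zero    v = cong (λ k → fromWord′ k v) (sym (ℕP.+-identityʳ n))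
fromWord′-replicate n (suc m) v =
  trans (fromWord′-replicate (suc n) m v) (cong (λ k → fromWord′ k v) (sym (ℕP.+-suc n m)))

fromWord-word : ∀ a → IsComposition a → fromWord (word a) ≡ a
fromWord-word []           _        = refl
fromWord-word (suc x ∷ xs) (_ ∷ xs!) =
  trans (fromWord′-replicate 0 x (true ∷ word xs)) (cong (suc x ∷_) (fromWord-word xs xs!))

word-fromWord′ : ∀ n w → word (fromWord′ n (w ++ true ∷ [])) ≡ replicate n false ++ w ++ true ∷ []
word-fromWord′ n []          = refl
word-fromWord′ n (false ∷ w) = trans (word-fromWord′ (suc n) w) (replicate-suc n (w ++ true ∷ []))
  where
  replicate-suc : ∀ n (v : List Bool) → replicate (suc n) false ++ v ≡ replicate n false ++ false ∷ v
  replicate-suc zero    v = refl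
  replicate-suc (suc n) v = cong (false ∷_) (replicate-suc n v)
word-fromWord′ n (true ∷ w)  = cong (λ v → replicate n false ++ true ∷ v) (word-fromWord′ 0 w)

word-∷ʳ : ∀ x xs → ∃[ w ] word (x ∷ xs) ≡ w ++ true ∷ []
word-∷ʳ x []       = replicate (x ∸ 1) false , refl
word-∷ʳ x (y ∷ ys) with word-∷ʳ y ys
... | w , eq = replicate (x ∸ 1) false ++ true ∷ w ,
  trans (cong (λ v → replicate (x ∸ 1) false ++ true ∷ v) eq)
        (sym (ListP.++-assoc (replicate (x ∸ 1) false) (true ∷ w) (true ∷ [])))

dual-admissible : ∀ a → Admissible (dual a)
dual-admissible []       = [] , refl
dual-admissible (x ∷ xs) with word-∷ʳ x xs
... | w , eq = fromWord′-isComposition 0 (dualWord (word (x ∷ xs))) , head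
  where
  head : admHead (dual (x ∷ xs)) ≡ true
  head rewrite eq | dualWord-∷ʳ w true = admHead-fromWord′ 0 (dualWord w)

dual-isComposition : ∀ a → IsComposition (dual a)
dual-isComposition a = proj₁ (dual-admissible a)

word-dual : ∀ a → Admissible a → word (dual a) ≡ dualWord (word a)
word-dual []                   _ = refl
word-dual (suc (suc x) ∷ xs) _ =
  trans (cong (word ∘ fromWord) eq) (trans (word-fromWord′ 0 (dualWord w)) (sym eq))
  where
  w = replicate x false ++ true ∷ word xs
  eq : dualWord (false ∷ w) ≡ dualWord w ++ true ∷ []
  eq = dualWord-∷ false w

dual-involutive : ∀ a → Admissible a → dual (dual a) ≡ a
dual-involutive a a-adm@(a-comp , _) =
  trans (cong (fromWord ∘ dualWord) (word-dual a a-adm))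
        (trans (cong fromWord (dualWord-involutive (word a))) (fromWord-word a a-comp))

ones zeros : List Bool → ℕ
ones []          = 0
ones (true ∷ u)  = suc (ones u)
ones (false ∷ u) = ones u
zeros []          = 0
zeros (true ∷ u)  = zeros u
zeros (false ∷ u) = suc (zeros u)

ones-++ : ∀ u v → ones (u ++ v) ≡ ones u ℕ.+ ones v
ones-++ []          v = refl
ones-++ (true ∷ u)  v = cong suc (ones-++ u v)
ones-++ (false ∷ u) v = ones-++ u v

ones-dualWord : ∀ u → ones (dualWord u) ≡ zeros u
ones-dualWord []      = refl
ones-dualWord (b ∷ u) =
  trans (cong ones (dualWord-∷ b u))
        (trans (ones-++ (dualWord u) (not b ∷ [])) (trans (cong (ℕ._+ ones (not b ∷ [])) (ones-dualWord u)) (last b)))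
  where
  last : ∀ b → zeros u ℕ.+ ones (not b ∷ []) ≡ zeros (b ∷ u)
  last true  = ℕP.+-identityʳ _
  last false = ℕP.+-comm (zeros u) 1

ones+zeros : ∀ u → ones u ℕ.+ zeros u ≡ length u
ones+zeros []          = refl
ones+zeros (true ∷ u)  = cong suc (ones+zeros u)
ones+zeros (false ∷ u) = trans (ℕP.+-suc (ones u) (zeros u)) (cong suc (ones+zeros u))

depth≡ones-word : ∀ a → depth a ≡ ones (word a)
depth≡ones-word []       = refl
depth≡ones-word (x ∷ xs) = trans (cong suc (depth≡ones-word xs)) (sym (ones-replicate (x ∸ 1)))
  where
  ones-replicate : ∀ m → ones (replicate m false ++ true ∷ word xs) ≡ suc (ones (word xs))
  ones-replicate zero    = refl
  ones-replicate (suc m) = ones-replicate m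

weight≡length-word : ∀ a → IsComposition a → weight a ≡ length (word a)
weight≡length-word []           _         = refl
weight≡length-word (suc x ∷ xs) (_ ∷ xs!) = begin
  suc x ℕ.+ weight xs                         ≡⟨ cong (suc x ℕ.+_) (weight≡length-word xs xs!) ⟩
  suc x ℕ.+ length (word xs)                  ≡⟨ ℕP.+-suc x _ ⟨
  x ℕ.+ length (true ∷ word xs)               ≡⟨ cong (ℕ._+ _) (ListP.length-replicate x) ⟨
  length (replicate x false) ℕ.+ length (true ∷ word xs) ≡⟨ ListP.length-++ (replicate x false) ⟨
  length (word (suc x ∷ xs))                  ∎
  where open ≡-Reasoning

weight-dual : ∀ a → Admissible a → weight (dual a) ≡ weight a
weight-dual a a-adm = begin
  weight (dual a)              ≡⟨ weight≡length-word (dual a) (dual-isComposition a) ⟩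
  length (word (dual a))       ≡⟨ cong length (word-dual a a-adm) ⟩
  length (dualWord (word a))   ≡⟨ length-dualWord (word a) ⟩
  length (word a)              ≡⟨ weight≡length-word a (proj₁ a-adm) ⟨
  weight a                     ∎
  where open ≡-Reasoning

depth-dual : ∀ a → Admissible a → depth (dual a) ℕ.+ depth a ≡ weight a
depth-dual a a-adm = begin
  depth (dual a) ℕ.+ depth a                   ≡⟨ cong₂ ℕ._+_ (depth≡ones-word (dual a)) (depth≡ones-word a) ⟩
  ones (word (dual a)) ℕ.+ ones (word a)       ≡⟨ cong (λ u → ones u ℕ.+ ones (word a)) (word-dual a a-adm) ⟩
  ones (dualWord (word a)) ℕ.+ ones (word a)   ≡⟨ cong (ℕ._+ ones (word a)) (ones-dualWord (word a)) ⟩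
  zeros (word a) ℕ.+ ones (word a)             ≡⟨ ℕP.+-comm (zeros (word a)) _ ⟩
  ones (word a) ℕ.+ zeros (word a)             ≡⟨ ones+zeros (word a) ⟩
  length (word a)                              ≡⟨ weight≡length-word a (proj₁ a-adm) ⟨
  weight a                                     ∎
  where open ≡-Reasoning

ascent : Bool → Bool → ℕ
ascent p b = if not p ∧ b then 1 else 0

ascents : Bool → List Bool → ℕ
ascents p []      = 0
ascents p (b ∷ u) = ascent p b ℕ.+ ascents b u

height≡ascents-word : ∀ a → IsComposition a → height a ≡ ascents true (word a)
height≡ascents-word []                 _         = refl
height≡ascents-word (suc zero ∷ xs)    (_ ∷ xs!) = height≡ascents-word xs xs!
height≡ascents-word (suc (suc x) ∷ xs) (_ ∷ xs!) =
  trans (cong suc (height≡ascents-word xs xs!)) (sym (ascents-replicate x))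
  where
  ascents-replicate : ∀ m → ascents false (replicate m false ++ true ∷ word xs) ≡ suc (ascents true (word xs))
  ascents-replicate zero    = refl
  ascents-replicate (suc m) = ascents-replicate m

lastOr headOr : Bool → List Bool → Bool
lastOr p []      = p
lastOr p (b ∷ u) = lastOr b u
headOr p []      = p
headOr p (b ∷ u) = b

ascents-∷ʳ : ∀ p u b → ascents p (u ++ b ∷ []) ≡ ascents p u ℕ.+ ascent (lastOr p u) b
ascents-∷ʳ p []      b = ℕP.+-identityʳ (ascent p b)
ascents-∷ʳ p (c ∷ u) b =
  trans (cong (ascent p c ℕ.+_) (ascents-∷ʳ c u b)) (sym (ℕP.+-assoc (ascent p c) _ _))

lastOr-∷ʳ : ∀ p u b → lastOr p (u ++ b ∷ []) ≡ b
lastOr-∷ʳ p []      b = refl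
lastOr-∷ʳ p (c ∷ u) b = lastOr-∷ʳ c u b

lastOr-dualWord : ∀ u → lastOr true (dualWord u) ≡ not (headOr false u)
lastOr-dualWord []      = refl
lastOr-dualWord (b ∷ u) = trans (cong (lastOr true) (dualWord-∷ b u)) (lastOr-∷ʳ true (dualWord u) (not b))

ascents-any : ∀ p u → ascents p u ≡ ascents true u ℕ.+ ascent (not (headOr false u)) (not p)
ascents-any p []      = refl
ascents-any p (b ∷ u) =
  trans (ℕP.+-comm (ascent p b) _) (cong (ascents b u ℕ.+_) (cong (λ β → if β then 1 else 0)
    (trans (∧-comm (not p) b) (cong (_∧ not p) (sym (not-involutive b))))))

ascents-dualWord : ∀ u → ascents true (dualWord u) ≡ ascents true u
ascents-dualWord []      = refl
ascents-dualWord (b ∷ u) = begin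
  ascents true (dualWord (b ∷ u))
    ≡⟨ cong (ascents true) (dualWord-∷ b u) ⟩
  ascents true (dualWord u ++ not b ∷ [])
    ≡⟨ ascents-∷ʳ true (dualWord u) (not b) ⟩
  ascents true (dualWord u) ℕ.+ ascent (lastOr true (dualWord u)) (not b)
    ≡⟨ cong₂ (λ m p → m ℕ.+ ascent p (not b)) (ascents-dualWord u) (lastOr-dualWord u) ⟩
  ascents true u ℕ.+ ascent (not (headOr false u)) (not b)
    ≡⟨ ascents-any b u ⟨
  ascents b u ∎
  where open ≡-Reasoning

height-dual : ∀ a → Admissible a → height (dual a) ≡ height a
height-dual a a-adm = begin
  height (dual a)                      ≡⟨ height≡ascents-word (dual a) (dual-isComposition a) ⟩
  ascents true (word (dual a))         ≡⟨ cong (ascents true) (word-dual a a-adm) ⟩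
  ascents true (dualWord (word a))     ≡⟨ ascents-dualWord (word a) ⟩
  ascents true (word a)                ≡⟨ height≡ascents-word a (proj₁ a-adm) ⟨
  height a                             ∎
  where open ≡-Reasoning

AdmissibleOfWeight : ℕ → Composition → Set
AdmissibleOfWeight k a = Admissible a × weight a ≡ k

𝒜 : ℕ → List Composition
𝒜 = admissibleOfWeight

extensions : List Bool → List (List Bool)
extensions w = (false ∷ w) ∷ (true ∷ w) ∷ []

admissibleOfWeight-nonempty : ∀ {k a} → 1 ≤ k → AdmissibleOfWeight k a → a ≢ []
admissibleOfWeight-nonempty 1≤k (_ , weight≡k) refl = ℕP.<-irrefl weight≡k 1≤k

words-unique : ∀ n → Unique (words n)
words-unique zero    = [] ∷ []
words-unique (suc n) = extend (words-unique n)
  where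
  extend : ∀ {ws} → Unique ws → Unique (concatMap extensions ws)
  extend []                         = []
  extend {w ∷ ws} (w∉ws ∷ ws!) = ((λ ()) ∷ All.tabulate (fresh false)) ∷ All.tabulate (fresh true) ∷ extend ws!
    where
    tail-∈ : ∀ {b} → b ∷ w ∈ concatMap extensions ws → w ∈ ws
    tail-∈ b∷w∈ = Any.map (λ { (here refl) → refl ; (there (here refl)) → refl }) (∈-concatMap⁻ _ {xs = ws} b∷w∈)
    fresh : ∀ b {v} → v ∈ concatMap extensions ws → b ∷ w ≢ v
    fresh b v∈ refl = All.lookup w∉ws (tail-∈ v∈) refl

∈-words : ∀ w → w ∈ words (length w)
∈-words []      = here refl
∈-words (b ∷ w) = ∈-concatMap⁺ _ {xs = words (length w)} (Any.map (λ { refl → head b }) (∈-words w))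
  where
  head : ∀ b → b ∷ w ∈ (false ∷ w) ∷ (true ∷ w) ∷ []
  head false = here refl
  head true  = there (here refl)

length-∈-words : ∀ n {w} → w ∈ words n → length w ≡ n
length-∈-words zero    (here refl) = refl
length-∈-words (suc n) w∈          with find (∈-concatMap⁻ _ {xs = words n} w∈)
... | v , v∈ , here refl         = cong suc (length-∈-words n v∈)
... | v , v∈ , there (here refl) = cong suc (length-∈-words n v∈)

fromWord1 : List Bool → Composition
fromWord1 w = fromWord (w ∷ʳ true)

word-fromWord1 : ∀ w → word (fromWord1 w) ≡ w ∷ʳ true
word-fromWord1 = word-fromWord′ 0

∈-admissibleOfWeight⁻ : ∀ k {a} → a ∈ admissibleOfWeight k → AdmissibleOfWeight k a
∈-admissibleOfWeight⁻ zero    (here refl) = ([] , refl) , refl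
∈-admissibleOfWeight⁻ (suc n) a∈ with ∈-filter⁻ (λ a → admHead a Bool.≟ true) {xs = map fromWord1 (words n)} a∈
... | a∈map , head with ∈-map⁻ fromWord1 a∈map
... | w , w∈ , refl = (fromWord′-isComposition 0 (w ++ true ∷ []) , head) , weight≡suc
  where
  weight≡suc : weight (fromWord1 w) ≡ suc n
  weight≡suc = begin
    weight (fromWord1 w)           ≡⟨ weight≡length-word _ (fromWord′-isComposition 0 (w ∷ʳ true)) ⟩
    length (word (fromWord1 w))    ≡⟨ cong length (word-fromWord1 w) ⟩
    length (w ++ true ∷ [])                      ≡⟨ ListP.length-++ w ⟩
    length w ℕ.+ 1                               ≡⟨ ℕP.+-comm (length w) 1 ⟩
    suc (length w)                               ≡⟨ cong suc (length-∈-words n w∈) ⟩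
    suc n                                        ∎
    where open ≡-Reasoning

weight≡0⇒[] : ∀ {a} → IsComposition a → weight a ≡ 0 → a ≡ []
weight≡0⇒[] {[]}        _ _ = refl
weight≡0⇒[] {zero ∷ _}  (() ∷ _) _
weight≡0⇒[] {suc x ∷ _} _        ()

∈-admissibleOfWeight⁺ : ∀ k {a} → AdmissibleOfWeight k a → a ∈ admissibleOfWeight k
∈-admissibleOfWeight⁺ zero    ((a-comp , _) , weight≡0) rewrite weight≡0⇒[] a-comp weight≡0 = here refl
∈-admissibleOfWeight⁺ (suc n) {[]}     (_ , ())
∈-admissibleOfWeight⁺ (suc n) {x ∷ xs} ((a-comp , head) , weight≡) with word-∷ʳ x xs
... | w , word≡ = ∈-filter⁺ (λ a → admHead a Bool.≟ true) (subst (_∈ map fromWord1 (words n)) a≡ (∈-map⁺ fromWord1 w∈)) head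
  where
  a≡ : fromWord1 w ≡ x ∷ xs
  a≡ = trans (cong fromWord (sym word≡)) (fromWord-word (x ∷ xs) a-comp)
  length-w : length w ≡ n
  length-w = ℕP.suc-injective (begin
    suc (length w)          ≡⟨ ℕP.+-comm 1 (length w) ⟩
    length w ℕ.+ 1          ≡⟨ ListP.length-++ w ⟨
    length (w ++ true ∷ []) ≡⟨ cong length word≡ ⟨
    length (word (x ∷ xs))  ≡⟨ weight≡length-word (x ∷ xs) a-comp ⟨
    weight (x ∷ xs)         ≡⟨ weight≡ ⟩
    suc n                   ∎)
    where open ≡-Reasoning
  w∈ : w ∈ words n
  w∈ = subst (λ m → w ∈ words m) length-w (∈-words w)

admissibleOfWeight-unique : ∀ k → Unique (admissibleOfWeight k)
admissibleOfWeight-unique zero    = [] ∷ []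
admissibleOfWeight-unique (suc n) =
  Unique.filter⁺ (λ a → admHead a Bool.≟ true) (Unique.map⁺ fromWord1-injective (words-unique n))
  where
  fromWord1-injective : ∀ {w v} → fromWord1 w ≡ fromWord1 v → w ≡ v
  fromWord1-injective {w} {v} eq =
    ListP.∷ʳ-injectiveˡ w v (trans (sym (word-fromWord1 w)) (trans (cong word eq) (word-fromWord1 v)))

∑-𝟙-admissibleOfWeight : ∀ k {z} (f : Composition → ℤ) → AdmissibleOfWeight k z →
                         ∑[ a ∈ admissibleOfWeight k ] (𝟙 z a * f a) ≡ f z
∑-𝟙-admissibleOfWeight k f z-adm = ∑-𝟙-∈ f (admissibleOfWeight-unique k) (∈-admissibleOfWeight⁺ k z-adm)

∑-𝟙-admissibleOfWeight-∉ : ∀ k {z} (f : Composition → ℤ) → ¬ AdmissibleOfWeight k z →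
                           ∑[ a ∈ admissibleOfWeight k ] (𝟙 z a * f a) ≡ 0ℤ
∑-𝟙-admissibleOfWeight-∉ k f z-nadm = ∑-𝟙-∉ f (z-nadm ∘ ∈-admissibleOfWeight⁻ k)

init-∷ʳ : ∀ y (t : ℕ) → init (y ∷ʳ t) ≡ y
init-∷ʳ []           t = refl
init-∷ʳ (x ∷ [])     t = refl
init-∷ʳ (x ∷ y ∷ ys) t = cong (x ∷_) (init-∷ʳ (y ∷ ys) t)

∷ʳ≢[] : ∀ y {t : ℕ} → y ∷ʳ t ≢ []
∷ʳ≢[] []      ()
∷ʳ≢[] (_ ∷ _) ()

weight-∷ʳ : ∀ y t → weight (y ∷ʳ t) ≡ weight y ℕ.+ t
weight-∷ʳ []      t = ℕP.+-identityʳ t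
weight-∷ʳ (x ∷ y) t = trans (cong (x ℕ.+_) (weight-∷ʳ y t)) (sym (ℕP.+-assoc x _ t))

depth-∷ʳ : ∀ y (t : ℕ) → depth (y ∷ʳ t) ≡ suc (depth y)
depth-∷ʳ y t = trans (ListP.length-++ y) (ℕP.+-comm (length y) 1)

atLeast2 : ℕ → ℕ
atLeast2 t = if 2 ℕ.≤ᵇ t then 1 else 0

height-∷ʳ : ∀ y t → height (y ∷ʳ t) ≡ height y ℕ.+ atLeast2 t
height-∷ʳ []      t = ℕP.+-identityʳ (atLeast2 t)
height-∷ʳ (x ∷ y) t = trans (cong (atLeast2 x ℕ.+_) (height-∷ʳ y t)) (sym (ℕP.+-assoc (atLeast2 x) _ _))

∷ʳ-admissible : ∀ {y t} → Admissible y → y ≢ [] → 1 ≤ t → Admissible (y ∷ʳ t)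
∷ʳ-admissible {[]}    _                   y≢[] _   = ⊥-elim (y≢[] refl)
∷ʳ-admissible {x ∷ y} (y-comp , y-head) _    1≤t = AllP.++⁺ y-comp (1≤t ∷ []) , y-head

[_]-admissible : ∀ t → 2 ≤ t → Admissible (t ∷ [])
[_]-admissible (suc (suc t)) _           = (s≤s z≤n ∷ []) , refl
[_]-admissible (suc zero)    (s≤s ())

init-isComposition : ∀ {a} → IsComposition a → IsComposition (init a)
init-isComposition {[]}         []                 = []
init-isComposition {x ∷ []}     _                  = []
init-isComposition {x ∷ y ∷ ys} (x≥1 ∷ y∷ys-comp) = x≥1 ∷ init-isComposition y∷ys-comp

init-admissible : ∀ {a} → Admissible a → Admissible (init a)
init-admissible {[]}         a-adm            = a-adm
init-admissible {x ∷ []}     _                = [] , refl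
init-admissible {x ∷ y ∷ ys} (a-comp , head) = init-isComposition a-comp , head

fin-admissible : ∀ a → Admissible (fin a)
fin-admissible a = dual-admissible (init (dual a))

mid-admissible : ∀ a → Admissible (mid a)
mid-admissible a = init-admissible (fin-admissible a)

init≡⇔≡∷ʳ : ∀ {k a} y → 1 ≤ k → AdmissibleOfWeight k a → init a ≡ y ⇔ a ≡ y ∷ʳ (k ∸ weight y)
init≡⇔≡∷ʳ {k} {a} y 1≤k (_ , weight≡k) with initLast a
... | []       = ⊥-elim (ℕP.<-irrefl weight≡k 1≤k)
... | u ∷ʳ′ t = mk⇔ to from
  where
  t≡ : t ≡ k ∸ weight u
  t≡ = sym (trans (cong (_∸ weight u) (trans (sym weight≡k) (weight-∷ʳ u t))) (ℕP.m+n∸m≡n (weight u) t))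
  to : init (u ∷ʳ t) ≡ y → u ∷ʳ t ≡ y ∷ʳ (k ∸ weight y)
  to eq with refl ← trans (sym (init-∷ʳ u t)) eq = cong (u ∷ʳ_) t≡
  from : u ∷ʳ t ≡ y ∷ʳ (k ∸ weight y) → init (u ∷ʳ t) ≡ y
  from eq = trans (init-∷ʳ u t) (ListP.∷ʳ-injectiveˡ u y eq)

init-injective : ∀ {k a b} → 1 ≤ k → AdmissibleOfWeight k a → AdmissibleOfWeight k b → init a ≡ init b → a ≡ b
init-injective {b = b} 1≤k a-adm b-adm eq =
  trans (Equivalence.to (init≡⇔≡∷ʳ (init b) 1≤k a-adm) eq)
        (sym (Equivalence.to (init≡⇔≡∷ʳ (init b) 1≤k b-adm) refl))

sg : ℕ → ℤ
sg n = -1ℤ ^ n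

sg-+ : ∀ m n → sg (m ℕ.+ n) ≡ sg m * sg n
sg-+ = ℤP.^-distribˡ-+-* -1ℤ

sg-square : ∀ n → sg n * sg n ≡ 1ℤ
sg-square zero    = refl
sg-square (suc n) = trans (neg-square (sg n)) (sg-square n)
  where
  neg-square : ∀ x → (-1ℤ * x) * (-1ℤ * x) ≡ x * x
  neg-square = solve-∀

sg-double : ∀ n → sg (n ℕ.+ n) ≡ 1ℤ
sg-double n = trans (sg-+ n n) (sg-square n)

sg-even : ∀ n → sg (2 ℕ.* n) ≡ 1ℤ
sg-even n = trans (cong (λ m → sg (n ℕ.+ m)) (ℕP.+-identityʳ n)) (sg-double n)

c : Composition → ℤ
c a = sg (depth a) * (+ 4) ^ (height a ∸ 1)

c-dual : ∀ {a} → Admissible a → c (dual a) ≡ sg (weight a) * c a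
c-dual {a} a-adm = begin
  sg (depth (dual a)) * (+ 4) ^ (height (dual a) ∸ 1)
    ≡⟨ cong₂ (λ s h → s * (+ 4) ^ (h ∸ 1)) sg-depth (height-dual a a-adm) ⟩
  sg (weight a) * sg (depth a) * (+ 4) ^ (height a ∸ 1)
    ≡⟨ ℤP.*-assoc (sg (weight a)) _ _ ⟩
  sg (weight a) * c a ∎
  where
  open ≡-Reasoning
  sg-depth : sg (depth (dual a)) ≡ sg (weight a) * sg (depth a)
  sg-depth = begin
    sg (depth (dual a))                                 ≡⟨ ℤP.*-identityʳ _ ⟨
    sg (depth (dual a)) * 1ℤ                            ≡⟨ cong (sg (depth (dual a)) *_) (sg-square (depth a)) ⟨
    sg (depth (dual a)) * (sg (depth a) * sg (depth a)) ≡⟨ ℤP.*-assoc (sg (depth (dual a))) _ _ ⟨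
    sg (depth (dual a)) * sg (depth a) * sg (depth a)   ≡⟨ cong (_* sg (depth a)) (sg-+ (depth (dual a)) (depth a)) ⟨
    sg (depth (dual a) ℕ.+ depth a) * sg (depth a)      ≡⟨ cong (λ n → sg n * sg (depth a)) (depth-dual a a-adm) ⟩
    sg (weight a) * sg (depth a)                        ∎

height-positive : ∀ {y} → Admissible y → y ≢ [] → 1 ≤ height y
height-positive {[]}               _           y≢[] = ⊥-elim (y≢[] refl)
height-positive {suc (suc x) ∷ _} _           _    = s≤s z≤n
height-positive {suc zero ∷ _}    (_ , ())    _
height-positive {zero ∷ _}        (_ , ())    _

c-∷ʳ : ∀ {y} t → Admissible y → y ≢ [] → c (y ∷ʳ t) ≡ -1ℤ * c y * (+ 4) ^ atLeast2 t
c-∷ʳ {y} t y-adm y≢[] = begin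
  sg (depth (y ∷ʳ t)) * (+ 4) ^ (height (y ∷ʳ t) ∸ 1)
    ≡⟨ cong₂ (λ d h → sg d * (+ 4) ^ (h ∸ 1)) (depth-∷ʳ y t) (height-∷ʳ y t) ⟩
  -1ℤ * sg (depth y) * (+ 4) ^ ((height y ℕ.+ atLeast2 t) ∸ 1)
    ≡⟨ cong (λ e → -1ℤ * sg (depth y) * (+ 4) ^ e) (ℕP.+-∸-comm (atLeast2 t) (height-positive y-adm y≢[])) ⟩
  -1ℤ * sg (depth y) * (+ 4) ^ ((height y ∸ 1) ℕ.+ atLeast2 t)
    ≡⟨ cong (-1ℤ * sg (depth y) *_) (ℤP.^-distribˡ-+-* (+ 4) (height y ∸ 1) (atLeast2 t)) ⟩
  -1ℤ * sg (depth y) * ((+ 4) ^ (height y ∸ 1) * (+ 4) ^ atLeast2 t)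
    ≡⟨ reassoc (sg (depth y)) _ _ ⟩
  -1ℤ * c y * (+ 4) ^ atLeast2 t ∎
  where
  open ≡-Reasoning
  reassoc : ∀ s e f → -1ℤ * s * (e * f) ≡ -1ℤ * (s * e) * f
  reassoc = solve-∀

dual-admissibleOfWeight : ∀ {k a} → AdmissibleOfWeight k a → AdmissibleOfWeight k (dual a)
dual-admissibleOfWeight {a = a} (a-adm , weight≡k) = dual-admissible a , trans (weight-dual a a-adm) weight≡k

𝟙-dual : ∀ {p q} → Admissible p → Admissible q → 𝟙 (dual p) q ≡ 𝟙 p (dual q)
𝟙-dual {p} {q} p-adm q-adm = 𝟙-cong-⇔ (mk⇔
  (λ eq → trans (sym (dual-involutive p p-adm)) (cong dual eq))
  (λ eq → trans (cong dual eq) (dual-involutive q q-adm)))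

𝟙-dual-nonadmissible : ∀ p {q} → ¬ Admissible q → 𝟙 (dual p) q ≡ 0ℤ
𝟙-dual-nonadmissible p q-nadm = 𝟙-≢ (λ eq → q-nadm (subst Admissible eq (dual-admissible p)))

∑-admissibleOfWeight-dual : ∀ k (f : Composition → ℤ) → ∑[ a ∈ 𝒜 k ] f (dual a) ≡ ∑ (𝒜 k) f
∑-admissibleOfWeight-dual k f = begin
  ∑[ a ∈ 𝒜 k ] f (dual a)
    ≡⟨ ∑-cong-∈ (𝒜 k) (λ a∈ → sym (∑-𝟙-admissibleOfWeight k f (dual-admissibleOfWeight (∈-admissibleOfWeight⁻ k a∈)))) ⟩
  ∑[ a ∈ 𝒜 k ] ∑[ b ∈ 𝒜 k ] (𝟙 (dual a) b * f b)
    ≡⟨ ∑-comm (𝒜 k) (𝒜 k) _ ⟩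
  ∑[ b ∈ 𝒜 k ] ∑[ a ∈ 𝒜 k ] (𝟙 (dual a) b * f b)
    ≡⟨ ∑-cong-∈ (𝒜 k) (λ {b} b∈ → trans (∑-cong-∈ (𝒜 k) (λ a∈ → cong (_* f b) (flip a∈ b∈)))
                                     (∑-𝟙-admissibleOfWeight k _ (dual-admissibleOfWeight (∈-admissibleOfWeight⁻ k b∈)))) ⟩
  ∑ (𝒜 k) f ∎
  where
  open ≡-Reasoning
  flip : ∀ {a b} → a ∈ 𝒜 k → b ∈ 𝒜 k → 𝟙 (dual a) b ≡ 𝟙 (dual b) a
  flip {a} {b} a∈ b∈ = trans (𝟙-dual (proj₁ (∈-admissibleOfWeight⁻ k a∈)) (proj₁ (∈-admissibleOfWeight⁻ k b∈))) (𝟙-sym a (dual b))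

imageCoeff : ℕ → (Composition → Composition) → Composition → ℤ
imageCoeff k g y = ∑[ a ∈ 𝒜 k ] (c a * 𝟙 (g a) y)

imageCoeff-id-∉ : ∀ k {z} → ¬ AdmissibleOfWeight k z → imageCoeff k id z ≡ 0ℤ
imageCoeff-id-∉ k {z} z∉ = begin
  ∑[ a ∈ 𝒜 k ] (c a * 𝟙 a z)   ≡⟨ ∑-cong (𝒜 k) (λ a → trans (ℤP.*-comm (c a) _) (cong (_* c a) (𝟙-sym a z))) ⟩
  ∑[ a ∈ 𝒜 k ] (𝟙 z a * c a)   ≡⟨ ∑-𝟙-admissibleOfWeight-∉ k {z} c z∉ ⟩
  0ℤ                           ∎
  where open ≡-Reasoning

imageCoeff-id : ∀ k {z} → Admissible z → imageCoeff k id z ≡ ℕ𝟙.𝟙 (weight z) k * c z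
imageCoeff-id k {z} z-adm with weight z ℕ.≟ k
... | yes weight≡k = begin
  ∑[ a ∈ 𝒜 k ] (c a * 𝟙 a z)   ≡⟨ ∑-cong (𝒜 k) (λ a → trans (ℤP.*-comm (c a) _) (cong (_* c a) (𝟙-sym a z))) ⟩
  ∑[ a ∈ 𝒜 k ] (𝟙 z a * c a)   ≡⟨ ∑-𝟙-admissibleOfWeight k c (z-adm , weight≡k) ⟩
  c z                          ≡⟨ ℤP.*-identityˡ (c z) ⟨
  1ℤ * c z                     ≡⟨ cong (_* c z) (ℕ𝟙.𝟙-≡ weight≡k) ⟨
  ℕ𝟙.𝟙 (weight z) k * c z      ∎
  where open ≡-Reasoning
... | no  weight≢k = begin
  imageCoeff k id z         ≡⟨ imageCoeff-id-∉ k (weight≢k ∘ proj₂) ⟩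
  0ℤ                        ≡⟨ ℤP.*-zeroˡ (c z) ⟨
  0ℤ * c z                  ≡⟨ cong (_* c z) (ℕ𝟙.𝟙-≢ weight≢k) ⟨
  ℕ𝟙.𝟙 (weight z) k * c z   ∎
  where open ≡-Reasoning

imageCoeff-init : ∀ {k} y → 1 ≤ k → imageCoeff k init y ≡ imageCoeff k id (y ∷ʳ (k ∸ weight y))
imageCoeff-init {k} y 1≤k =
  ∑-cong-∈ (𝒜 k) (λ {a} a∈ → cong (c a *_) (𝟙-cong-⇔ (init≡⇔≡∷ʳ y 1≤k (∈-admissibleOfWeight⁻ k a∈))))

imageCoeff-∘dual : ∀ n g y → imageCoeff (2 ℕ.* n) g y ≡ imageCoeff (2 ℕ.* n) (g ∘ dual) y
imageCoeff-∘dual n g y = begin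
  ∑[ a ∈ 𝒜 k ] (c a * 𝟙 (g a) y)
    ≡⟨ ∑-admissibleOfWeight-dual k (λ a → c a * 𝟙 (g a) y) ⟨
  ∑[ a ∈ 𝒜 k ] (c (dual a) * 𝟙 (g (dual a)) y)
    ≡⟨ ∑-cong-∈ (𝒜 k) (λ {a} a∈ → cong (_* 𝟙 (g (dual a)) y) (c-dual-even a∈)) ⟩
  ∑[ a ∈ 𝒜 k ] (c a * 𝟙 (g (dual a)) y) ∎
  where
  open ≡-Reasoning
  k = 2 ℕ.* n
  c-dual-even : ∀ {a} → a ∈ 𝒜 k → c (dual a) ≡ c a
  c-dual-even {a} a∈ with (a-adm , weight≡k) ← ∈-admissibleOfWeight⁻ k a∈ =
    trans (c-dual a-adm) (trans (cong (λ w → sg w * c a) weight≡k) (trans (cong (_* c a) (sg-even n)) (ℤP.*-identityˡ (c a))))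

imageCoeff-fin : ∀ n {y} → Admissible y → imageCoeff (2 ℕ.* n) fin y ≡ imageCoeff (2 ℕ.* n) init (dual y)
imageCoeff-fin n {y} y-adm = trans (imageCoeff-∘dual n fin y) (∑-cong-∈ (𝒜 k) (λ {a} a∈ → cong (c a *_) (fin-dual a∈)))
  where
  k = 2 ℕ.* n
  fin-dual : ∀ {a} → a ∈ 𝒜 k → 𝟙 (fin (dual a)) y ≡ 𝟙 (init a) (dual y)
  fin-dual {a} a∈ with (a-adm , _) ← ∈-admissibleOfWeight⁻ k a∈ =
    trans (cong (λ b → 𝟙 (dual (init b)) y) (dual-involutive a a-adm)) (𝟙-dual (init-admissible a-adm) y-adm)

imageCoeff-mid : ∀ n y → imageCoeff (2 ℕ.* n) mid y ≡ imageCoeff (2 ℕ.* n) (init ∘ dual ∘ init) y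
imageCoeff-mid n y = trans (imageCoeff-∘dual n mid y) (∑-cong-∈ (𝒜 k) (λ {a} a∈ → cong (λ b → c a * 𝟙 (init (dual (init b))) y) (mid-dual a∈)))
  where
  k = 2 ℕ.* n
  mid-dual : ∀ {a} → a ∈ 𝒜 k → dual (dual a) ≡ a
  mid-dual {a} a∈ = dual-involutive a (proj₁ (∈-admissibleOfWeight⁻ k a∈))

α : ℕ → ℕ → ℤ
α k w = if does (w ℕ.<? k) then (+ 4) ^ atLeast2 (k ∸ w) else 0ℤ

α-< : ∀ {k w} → w < k → α k w ≡ (+ 4) ^ atLeast2 (k ∸ w)
α-< {k} {w} w<k rewrite dec-true (w ℕ.<? k) w<k = refl

α-≮ : ∀ {k w} → ¬ w < k → α k w ≡ 0ℤ
α-≮ {k} {w} w≮k rewrite dec-false (w ℕ.<? k) w≮k = refl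

imageCoeff-init-nonempty : ∀ {k y} → 1 ≤ k → Admissible y → y ≢ [] →
                           imageCoeff k init y ≡ -1ℤ * c y * α k (weight y)
imageCoeff-init-nonempty {k} {y} 1≤k y-adm y≢[] with weight y ℕ.<? k
... | yes w<k = begin
  imageCoeff k init y                     ≡⟨ imageCoeff-init y 1≤k ⟩
  imageCoeff k id z                       ≡⟨ imageCoeff-id k z-adm ⟩
  ℕ𝟙.𝟙 (weight z) k * c z                 ≡⟨ cong (_* c z) (ℕ𝟙.𝟙-≡ (trans (weight-∷ʳ y _) (ℕP.m+[n∸m]≡n (ℕP.<⇒≤ w<k)))) ⟩
  1ℤ * c z                                ≡⟨ ℤP.*-identityˡ (c z) ⟩
  c z                                     ≡⟨ c-∷ʳ (k ∸ weight y) y-adm y≢[] ⟩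
  -1ℤ * c y * (+ 4) ^ atLeast2 (k ∸ weight y) ≡⟨ cong (-1ℤ * c y *_) (α-< w<k) ⟨
  -1ℤ * c y * α k (weight y)              ∎
  where
  open ≡-Reasoning
  z = y ∷ʳ (k ∸ weight y)
  z-adm : Admissible z
  z-adm = ∷ʳ-admissible y-adm y≢[] (ℕP.m<n⇒0<n∸m w<k)
... | no  w≮k = begin
  imageCoeff k init y           ≡⟨ imageCoeff-init y 1≤k ⟩
  imageCoeff k id (y ∷ʳ (k ∸ weight y)) ≡⟨ cong (λ t → imageCoeff k id (y ∷ʳ t)) (ℕP.m≤n⇒m∸n≡0 (ℕP.≮⇒≥ w≮k)) ⟩
  imageCoeff k id (y ∷ʳ 0)      ≡⟨ imageCoeff-id-∉ k (λ ((z-comp , _) , _) → last-positive (AllP.++⁻ʳ y z-comp)) ⟩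
  0ℤ                            ≡⟨ ℤP.*-zeroʳ (-1ℤ * c y) ⟨
  -1ℤ * c y * 0ℤ                ≡⟨ cong (-1ℤ * c y *_) (α-≮ w≮k) ⟨
  -1ℤ * c y * α k (weight y)    ∎
  where
  open ≡-Reasoning
  last-positive : ¬ All (1 ≤_) (0 ∷ [])
  last-positive (() ∷ _)

c-singleton : ∀ t → 2 ≤ t → c (t ∷ []) ≡ -1ℤ
c-singleton (suc (suc t)) _        = refl
c-singleton (suc zero)    (s≤s ())

imageCoeff-init-[] : ∀ {k} → 2 ≤ k → imageCoeff k init [] ≡ -1ℤ
imageCoeff-init-[] {k} 2≤k = begin
  imageCoeff k init []             ≡⟨ imageCoeff-init [] (ℕP.≤-trans (s≤s z≤n) 2≤k) ⟩
  imageCoeff k id (k ∷ [])         ≡⟨ imageCoeff-id k ([ k ]-admissible 2≤k) ⟩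
  ℕ𝟙.𝟙 (k ℕ.+ 0) k * c (k ∷ [])    ≡⟨ cong₂ _*_ (ℕ𝟙.𝟙-≡ (ℕP.+-identityʳ k)) (c-singleton k 2≤k) ⟩
  1ℤ * -1ℤ                         ≡⟨⟩
  -1ℤ                              ∎
  where open ≡-Reasoning

oneTo : ℕ → List ℕ
oneTo n = map suc (downFrom n)

oneTo-unique : ∀ n → Unique (oneTo n)
oneTo-unique n = Unique.map⁺ ℕP.suc-injective (Unique.downFrom⁺ n)

∈-oneTo⁺ : ∀ {n t} → 1 ≤ t → t ≤ n → t ∈ oneTo n
∈-oneTo⁺ {t = suc t} _ t<n = ∈-map⁺ suc (∈-downFrom⁺ t<n)

∈-oneTo⁻ : ∀ {n t} → t ∈ oneTo n → 1 ≤ t × t ≤ n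
∈-oneTo⁻ t∈ with ∈-map⁻ suc t∈
... | _ , t′∈ , refl = s≤s z≤n , ∈-downFrom⁻ t′∈

𝟙-∷ʳ : ∀ u y t s → 𝟙 (u ∷ʳ t) (y ∷ʳ s) ≡ 𝟙 u y * ℕ𝟙.𝟙 t s
𝟙-∷ʳ u y t s = by-cases (u ≟ᶜ y)
  where
  open ≡-Reasoning
  last-entries : Dec (t ≡ s) → 𝟙 (u ∷ʳ t) (u ∷ʳ s) ≡ ℕ𝟙.𝟙 t s
  last-entries (yes refl) = trans (𝟙-≡ {u ∷ʳ t} refl) (sym (ℕ𝟙.𝟙-≡ {t} refl))
  last-entries (no t≢s)   = trans (𝟙-≢ (t≢s ∘ ListP.∷ʳ-injectiveʳ u u)) (sym (ℕ𝟙.𝟙-≢ t≢s))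
  by-cases : Dec (u ≡ y) → 𝟙 (u ∷ʳ t) (y ∷ʳ s) ≡ 𝟙 u y * ℕ𝟙.𝟙 t s
  by-cases (yes refl) = begin
    𝟙 (u ∷ʳ t) (u ∷ʳ s)  ≡⟨ last-entries (t ℕ.≟ s) ⟩
    ℕ𝟙.𝟙 t s             ≡⟨ ℤP.*-identityˡ (ℕ𝟙.𝟙 t s) ⟨
    1ℤ * ℕ𝟙.𝟙 t s        ≡⟨ cong (_* ℕ𝟙.𝟙 t s) (𝟙-≡ {u} refl) ⟨
    𝟙 u u * ℕ𝟙.𝟙 t s     ∎
  by-cases (no u≢y) = begin
    𝟙 (u ∷ʳ t) (y ∷ʳ s)  ≡⟨ 𝟙-≢ (u≢y ∘ ListP.∷ʳ-injectiveˡ u y) ⟩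
    0ℤ                   ≡⟨ ℤP.*-zeroˡ (ℕ𝟙.𝟙 t s) ⟨
    0ℤ * ℕ𝟙.𝟙 t s        ≡⟨ cong (_* ℕ𝟙.𝟙 t s) (𝟙-≢ u≢y) ⟨
    𝟙 u y * ℕ𝟙.𝟙 t s     ∎

𝟙-init : ∀ N {b} y → IsComposition b → weight b ≤ N →
         𝟙 (init b) y ≡ 𝟙 b [] * 𝟙 [] y + ∑[ s ∈ oneTo N ] 𝟙 b (y ∷ʳ s)
𝟙-init N {b} y b-comp weight≤N with initLast b
... | [] = begin
  𝟙 [] y
    ≡⟨ ℤP.+-identityʳ (𝟙 [] y) ⟨
  𝟙 [] y + 0ℤ
    ≡⟨ cong₂ _+_ (ℤP.*-identityˡ (𝟙 [] y)) (trans (∑-cong-∈ (oneTo N) (λ _ → 𝟙-≢ (∷ʳ≢[] y ∘ sym))) (∑-zero (oneTo N))) ⟨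
  1ℤ * 𝟙 [] y + ∑[ s ∈ oneTo N ] 𝟙 [] (y ∷ʳ s) ∎
  where
  open ≡-Reasoning
... | u ∷ʳ′ t = begin
  𝟙 (init (u ∷ʳ t)) y
    ≡⟨ cong (λ v → 𝟙 v y) (init-∷ʳ u t) ⟩
  𝟙 u y
    ≡⟨ ℕ𝟙.∑-𝟙-∈ (λ _ → 𝟙 u y) (oneTo-unique N) t∈ ⟨
  ∑[ s ∈ oneTo N ] (ℕ𝟙.𝟙 t s * 𝟙 u y)
    ≡⟨ ∑-cong (oneTo N) (λ s → trans (ℤP.*-comm (ℕ𝟙.𝟙 t s) (𝟙 u y)) (sym (𝟙-∷ʳ u y t s))) ⟩
  ∑[ s ∈ oneTo N ] 𝟙 (u ∷ʳ t) (y ∷ʳ s)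
    ≡⟨ ℤP.+-identityˡ (∑[ s ∈ oneTo N ] 𝟙 (u ∷ʳ t) (y ∷ʳ s)) ⟨
  0ℤ + ∑[ s ∈ oneTo N ] 𝟙 (u ∷ʳ t) (y ∷ʳ s)
    ≡⟨ cong (_+ ∑[ s ∈ oneTo N ] 𝟙 (u ∷ʳ t) (y ∷ʳ s)) head-term ⟨
  𝟙 (u ∷ʳ t) [] * 𝟙 [] y + ∑[ s ∈ oneTo N ] 𝟙 (u ∷ʳ t) (y ∷ʳ s) ∎
  where
  open ≡-Reasoning
  head-term : 𝟙 (u ∷ʳ t) [] * 𝟙 [] y ≡ 0ℤ
  head-term = trans (cong (_* 𝟙 [] y) (𝟙-≢ (∷ʳ≢[] u))) (ℤP.*-zeroˡ (𝟙 [] y))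
  t∈ : t ∈ oneTo N
  t∈ with 1≤t ∷ _ ← AllP.++⁻ʳ u b-comp =
    ∈-oneTo⁺ 1≤t (ℕP.≤-trans (ℕP.m≤n+m t (weight u)) (ℕP.≤-trans (ℕP.≤-reflexive (sym (weight-∷ʳ u t))) weight≤N))

weight-init : ∀ a → weight (init a) ≤ weight a
weight-init []           = z≤n
weight-init (x ∷ [])     = z≤n
weight-init (x ∷ y ∷ ys) = ℕP.+-monoʳ-≤ x (weight-init (y ∷ ys))

imageCoeff-dual∘init : ∀ k {q} → Admissible q → imageCoeff k (dual ∘ init) q ≡ imageCoeff k init (dual q)
imageCoeff-dual∘init k q-adm = ∑-cong-∈ (𝒜 k) (λ {a} a∈ →
  cong (c a *_) (𝟙-dual (init-admissible (proj₁ (∈-admissibleOfWeight⁻ k a∈))) q-adm))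

imageCoeff-dual∘init-nonadmissible : ∀ k {q} → ¬ Admissible q → imageCoeff k (dual ∘ init) q ≡ 0ℤ
imageCoeff-dual∘init-nonadmissible k q-nadm =
  trans (∑-cong (𝒜 k) (λ a → trans (cong (c a *_) (𝟙-dual-nonadmissible (init a) q-nadm)) (ℤP.*-zeroʳ (c a))))
        (∑-zero (𝒜 k))

imageCoeff-init∘dual∘init : ∀ k y → imageCoeff k (init ∘ dual ∘ init) y ≡
  𝟙 [] y * imageCoeff k init [] + ∑[ s ∈ oneTo k ] imageCoeff k (dual ∘ init) (y ∷ʳ s)
imageCoeff-init∘dual∘init k y = begin
  ∑[ a ∈ 𝒜 k ] (c a * 𝟙 (init (dual (init a))) y)
    ≡⟨ ∑-cong-∈ (𝒜 k) split ⟩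
  ∑[ a ∈ 𝒜 k ] (𝟙 [] y * (c a * 𝟙 (init a) []) + ∑[ s ∈ oneTo k ] (c a * 𝟙 (dual (init a)) (y ∷ʳ s)))
    ≡⟨ ∑-+ (𝒜 k) _ _ ⟩
  ∑[ a ∈ 𝒜 k ] (𝟙 [] y * (c a * 𝟙 (init a) [])) + ∑[ a ∈ 𝒜 k ] ∑[ s ∈ oneTo k ] (c a * 𝟙 (dual (init a)) (y ∷ʳ s))
    ≡⟨ cong₂ _+_ (∑-*ˡ (𝒜 k) (𝟙 [] y) _) (∑-comm (𝒜 k) (oneTo k) _) ⟩
  𝟙 [] y * imageCoeff k init [] + ∑[ s ∈ oneTo k ] imageCoeff k (dual ∘ init) (y ∷ʳ s) ∎
  where
  open ≡-Reasoning
  distribute : ∀ c d e S → c * (d * e + S) ≡ e * (c * d) + c * S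
  distribute = solve-∀
  split : ∀ {a} → a ∈ 𝒜 k → c a * 𝟙 (init (dual (init a))) y ≡
          𝟙 [] y * (c a * 𝟙 (init a) []) + ∑[ s ∈ oneTo k ] (c a * 𝟙 (dual (init a)) (y ∷ʳ s))
  split {a} a∈ with (a-adm , weight≡k) ← ∈-admissibleOfWeight⁻ k a∈ = begin
    c a * 𝟙 (init (dual (init a))) y
      ≡⟨ cong (c a *_) (𝟙-init k y (dual-isComposition (init a)) weight≤k) ⟩
    c a * (𝟙 (dual (init a)) [] * 𝟙 [] y + ∑[ s ∈ oneTo k ] 𝟙 (dual (init a)) (y ∷ʳ s))
      ≡⟨ distribute (c a) _ (𝟙 [] y) _ ⟩
    𝟙 [] y * (c a * 𝟙 (dual (init a)) []) + c a * ∑[ s ∈ oneTo k ] 𝟙 (dual (init a)) (y ∷ʳ s)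
      ≡⟨ cong₂ (λ u v → 𝟙 [] y * (c a * u) + v) (𝟙-dual (init-admissible a-adm) ([] , refl)) (sym (∑-*ˡ (oneTo k) (c a) _)) ⟩
    𝟙 [] y * (c a * 𝟙 (init a) []) + ∑[ s ∈ oneTo k ] (c a * 𝟙 (dual (init a)) (y ∷ʳ s)) ∎
    where
    weight≤k : weight (dual (init a)) ≤ k
    weight≤k = ℕP.≤-trans (ℕP.≤-reflexive (weight-dual (init a) (init-admissible a-adm)))
                          (ℕP.≤-trans (weight-init a) (ℕP.≤-reflexive weight≡k))

β : ℕ → ℕ → ℤ
β k w = ∑[ s ∈ oneTo k ] (sg (w ℕ.+ s) * (+ 4) ^ atLeast2 s * α k (w ℕ.+ s))

dual-nonempty : ∀ {q} → Admissible q → q ≢ [] → dual q ≢ []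
dual-nonempty {q} q-adm q≢[] dual≡[] = q≢[] (trans (sym (dual-involutive q q-adm)) (cong dual dual≡[]))

imageCoeff-init∘dual∘init-nonempty : ∀ {k y} → 1 ≤ k → Admissible y → y ≢ [] →
                                     imageCoeff k (init ∘ dual ∘ init) y ≡ c y * β k (weight y)
imageCoeff-init∘dual∘init-nonempty {k} {y} 1≤k y-adm y≢[] = begin
  imageCoeff k (init ∘ dual ∘ init) y
    ≡⟨ imageCoeff-init∘dual∘init k y ⟩
  𝟙 [] y * imageCoeff k init [] + ∑[ s ∈ oneTo k ] imageCoeff k (dual ∘ init) (y ∷ʳ s)
    ≡⟨ cong₂ _+_ (trans (cong (_* imageCoeff k init []) (𝟙-≢ (y≢[] ∘ sym))) (ℤP.*-zeroˡ (imageCoeff k init []))) (∑-cong-∈ (oneTo k) term) ⟩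
  0ℤ + ∑[ s ∈ oneTo k ] (c y * (sg (w ℕ.+ s) * (+ 4) ^ atLeast2 s * α k (w ℕ.+ s)))
    ≡⟨ ℤP.+-identityˡ _ ⟩
  ∑[ s ∈ oneTo k ] (c y * (sg (w ℕ.+ s) * (+ 4) ^ atLeast2 s * α k (w ℕ.+ s)))
    ≡⟨ ∑-*ˡ (oneTo k) (c y) _ ⟩
  c y * β k w ∎
  where
  open ≡-Reasoning
  w = weight y
  rearrange : ∀ σ γ f a → -1ℤ * (σ * (-1ℤ * γ * f)) * a ≡ γ * (σ * f * a)
  rearrange = solve-∀
  term : ∀ {s} → s ∈ oneTo k → imageCoeff k (dual ∘ init) (y ∷ʳ s) ≡ c y * (sg (w ℕ.+ s) * (+ 4) ^ atLeast2 s * α k (w ℕ.+ s))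
  term {s} s∈ = begin
    imageCoeff k (dual ∘ init) q
      ≡⟨ imageCoeff-dual∘init k q-adm ⟩
    imageCoeff k init (dual q)
      ≡⟨ imageCoeff-init-nonempty 1≤k (dual-admissible q) (dual-nonempty q-adm (∷ʳ≢[] y)) ⟩
    -1ℤ * c (dual q) * α k (weight (dual q))
      ≡⟨ cong₂ (λ γ v → -1ℤ * γ * α k v) (c-dual q-adm) (weight-dual q q-adm) ⟩
    -1ℤ * (sg (weight q) * c q) * α k (weight q)
      ≡⟨ cong₂ (λ v γ → -1ℤ * (sg v * γ) * α k v) (weight-∷ʳ y s) (c-∷ʳ s y-adm y≢[]) ⟩
    -1ℤ * (sg (w ℕ.+ s) * (-1ℤ * c y * (+ 4) ^ atLeast2 s)) * α k (w ℕ.+ s)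
      ≡⟨ rearrange (sg (w ℕ.+ s)) (c y) _ _ ⟩
    c y * (sg (w ℕ.+ s) * (+ 4) ^ atLeast2 s * α k (w ℕ.+ s)) ∎
    where
    q = y ∷ʳ s
    q-adm = ∷ʳ-admissible y-adm y≢[] (proj₁ (∈-oneTo⁻ s∈))

∑-oneTo-truncate : ∀ {M} N (f : ℕ → ℤ) → M ≤ N → (∀ {s} → M < s → f s ≡ 0ℤ) → ∑ (oneTo N) f ≡ ∑ (oneTo M) f
∑-oneTo-truncate zero    f z≤n  _      = refl
∑-oneTo-truncate {M} (suc N) f M≤1+N vanish with M ℕ.≟ suc N
... | yes refl = refl
... | no  M≢1+N = begin
  f (suc N) + ∑ (oneTo N) f   ≡⟨ cong (_+ ∑ (oneTo N) f) (vanish M<1+N) ⟩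
  0ℤ + ∑ (oneTo N) f          ≡⟨ ℤP.+-identityˡ _ ⟩
  ∑ (oneTo N) f               ≡⟨ ∑-oneTo-truncate N f (ℕP.≤-pred M<1+N) vanish ⟩
  ∑ (oneTo M) f               ∎
  where
  open ≡-Reasoning
  M<1+N = ℕP.≤∧≢⇒< M≤1+N M≢1+N

∑-oneTo-pairs : ∀ (f : ℕ → ℤ) → (∀ n → f (3 ℕ.+ (n ℕ.+ n)) + f (4 ℕ.+ (n ℕ.+ n)) ≡ 0ℤ) →
                ∀ j → ∑ (oneTo (2 ℕ.+ (j ℕ.+ j))) f ≡ ∑ (oneTo 2) f
∑-oneTo-pairs f pair zero    = refl
∑-oneTo-pairs f pair (suc j) = begin
  ∑ (oneTo (2 ℕ.+ (suc j ℕ.+ suc j))) f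
    ≡⟨ cong (λ n → ∑ (oneTo (3 ℕ.+ n)) f) (ℕP.+-suc j j) ⟩
  f (4 ℕ.+ (j ℕ.+ j)) + (f (3 ℕ.+ (j ℕ.+ j)) + ∑ (oneTo (2 ℕ.+ (j ℕ.+ j))) f)
    ≡⟨ regroup (f (4 ℕ.+ (j ℕ.+ j))) (f (3 ℕ.+ (j ℕ.+ j))) _ ⟩
  (f (3 ℕ.+ (j ℕ.+ j)) + f (4 ℕ.+ (j ℕ.+ j))) + ∑ (oneTo (2 ℕ.+ (j ℕ.+ j))) f
    ≡⟨ cong₂ _+_ (pair j) (∑-oneTo-pairs f pair j) ⟩
  0ℤ + ∑ (oneTo 2) f
    ≡⟨ ℤP.+-identityˡ _ ⟩
  ∑ (oneTo 2) f ∎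
  where
  open ≡-Reasoning
  regroup : ∀ a b r → a + (b + r) ≡ (b + a) + r
  regroup = solve-∀

alternating-pair : ∀ n (e : ℤ) → sg (3 ℕ.+ n) * e + sg (4 ℕ.+ n) * e ≡ 0ℤ
alternating-pair n e = cancel (sg n) e
  where
  cancel : ∀ x e → -1ℤ * (-1ℤ * (-1ℤ * x)) * e + -1ℤ * (-1ℤ * (-1ℤ * (-1ℤ * x))) * e ≡ 0ℤ
  cancel = solve-∀

∑-oneTo-sg-weighted : ∀ j → ∑[ s ∈ oneTo (2 ℕ.+ (j ℕ.+ j)) ] (sg s * (+ 4) ^ atLeast2 s) ≡ + 3
∑-oneTo-sg-weighted = ∑-oneTo-pairs (λ s → sg s * (+ 4) ^ atLeast2 s) (λ n → alternating-pair (n ℕ.+ n) (+ 4))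

∑-oneTo-sg-from2 : ∀ j → ∑[ s ∈ oneTo (2 ℕ.+ (j ℕ.+ j)) ] (if 2 ℕ.≤ᵇ s then sg s else 0ℤ) ≡ 1ℤ
∑-oneTo-sg-from2 = ∑-oneTo-pairs (λ s → if 2 ℕ.≤ᵇ s then sg s else 0ℤ) λ n →
  trans (cong₂ _+_ (sym (ℤP.*-identityʳ (sg (3 ℕ.+ (n ℕ.+ n))))) (sym (ℤP.*-identityʳ (sg (4 ℕ.+ (n ℕ.+ n))))))
        (alternating-pair (n ℕ.+ n) 1ℤ)

γ : ℕ → ℤ
γ m = ∑[ s ∈ oneTo (m ∸ 1) ] (sg s * (+ 4) ^ atLeast2 s * (+ 4) ^ atLeast2 (m ∸ s))

atLeast2-≥2 : ∀ {t} → 2 ≤ t → atLeast2 t ≡ 1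
atLeast2-≥2 {suc (suc t)} _        = refl
atLeast2-≥2 {suc zero}    (s≤s ())

≤∸1⇒< : ∀ {s m} → 1 ≤ s → s ≤ m ∸ 1 → s < m
≤∸1⇒< {m = zero}  (s≤s _) ()
≤∸1⇒< {m = suc m} _       s≤m = s≤s s≤m

β≡γ : ∀ W m → β (W ℕ.+ W ℕ.+ m) (W ℕ.+ W) ≡ γ m
β≡γ W m = begin
  ∑[ s ∈ oneTo k ] (sg (w ℕ.+ s) * (+ 4) ^ atLeast2 s * α k (w ℕ.+ s))
    ≡⟨ ∑-oneTo-truncate k _ (ℕP.≤-trans (ℕP.m∸n≤m m 1) (ℕP.m≤n+m m w)) beyond ⟩
  ∑[ s ∈ oneTo (m ∸ 1) ] (sg (w ℕ.+ s) * (+ 4) ^ atLeast2 s * α k (w ℕ.+ s))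
    ≡⟨ ∑-cong-∈ (oneTo (m ∸ 1)) within ⟩
  γ m ∎
  where
  open ≡-Reasoning
  w = W ℕ.+ W
  k = w ℕ.+ m
  beyond : ∀ {s} → m ∸ 1 < s → sg (w ℕ.+ s) * (+ 4) ^ atLeast2 s * α k (w ℕ.+ s) ≡ 0ℤ
  beyond {s} m∸1<s = trans (cong (sg (w ℕ.+ s) * (+ 4) ^ atLeast2 s *_) (α-≮ (ℕP.≤⇒≯ k≤w+s))) (ℤP.*-zeroʳ (sg (w ℕ.+ s) * (+ 4) ^ atLeast2 s))
    where
    k≤w+s : k ≤ w ℕ.+ s
    k≤w+s = ℕP.+-monoʳ-≤ w (ℕP.≤-trans (ℕP.m≤n+m∸n m 1) m∸1<s)
  within : ∀ {s} → s ∈ oneTo (m ∸ 1) → sg (w ℕ.+ s) * (+ 4) ^ atLeast2 s * α k (w ℕ.+ s) ≡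
                                        sg s * (+ 4) ^ atLeast2 s * (+ 4) ^ atLeast2 (m ∸ s)
  within {s} s∈ with (1≤s , s≤m∸1) ← ∈-oneTo⁻ s∈ = cong₂ (λ σ a → σ * (+ 4) ^ atLeast2 s * a)
    (trans (sg-+ w s) (trans (cong (_* sg s) (sg-double W)) (ℤP.*-identityˡ (sg s))))
    (trans (α-< (ℕP.+-monoʳ-< w (≤∸1⇒< 1≤s s≤m∸1))) (cong (λ e → (+ 4) ^ atLeast2 e) (ℕP.[m+n]∸[m+o]≡n∸o w m s)))

γ-2 : γ 2 ≡ -1ℤ
γ-2 = refl

γ-even : ∀ j → γ (4 ℕ.+ (j ℕ.+ j)) ≡ + 8
γ-even j = begin
  γ (4 ℕ.+ x)
    ≡⟨⟩
  sg (3 ℕ.+ x) * + 4 * (+ 4) ^ atLeast2 ((1 ℕ.+ x) ∸ x) + ∑[ s ∈ oneTo (2 ℕ.+ x) ] (sg s * (+ 4) ^ atLeast2 s * (+ 4) ^ atLeast2 ((4 ℕ.+ x) ∸ s))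
    ≡⟨ cong₂ _+_ top (∑-cong-∈ (oneTo (2 ℕ.+ x)) rest) ⟩
  - + 4 + ∑[ s ∈ oneTo (2 ℕ.+ x) ] (sg s * (+ 4) ^ atLeast2 s * + 4)
    ≡⟨ cong (_+_ (- + 4)) (∑-*ʳ (oneTo (2 ℕ.+ x)) (λ s → sg s * (+ 4) ^ atLeast2 s) (+ 4)) ⟩
  - + 4 + ∑[ s ∈ oneTo (2 ℕ.+ x) ] (sg s * (+ 4) ^ atLeast2 s) * + 4
    ≡⟨ cong (λ r → - + 4 + r * + 4) (∑-oneTo-sg-weighted j) ⟩
  + 8 ∎
  where
  open ≡-Reasoning
  x = j ℕ.+ j
  top : sg (3 ℕ.+ x) * + 4 * (+ 4) ^ atLeast2 ((1 ℕ.+ x) ∸ x) ≡ - + 4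
  top = cong₂ (λ σ e → -1ℤ * (-1ℤ * (-1ℤ * σ)) * + 4 * (+ 4) ^ atLeast2 e) (sg-double j) (ℕP.m+n∸n≡m 1 x)
  rest : ∀ {s} → s ∈ oneTo (2 ℕ.+ x) → sg s * (+ 4) ^ atLeast2 s * (+ 4) ^ atLeast2 ((4 ℕ.+ x) ∸ s) ≡ sg s * (+ 4) ^ atLeast2 s * + 4
  rest {s} s∈ = cong (λ e → sg s * (+ 4) ^ atLeast2 s * (+ 4) ^ e)
    (atLeast2-≥2 (ℕP.m+n≤o⇒m≤o∸n 2 (ℕP.+-monoʳ-≤ 2 (proj₂ (∈-oneTo⁻ s∈)))))

α-offset : ∀ w {m} → 1 ≤ m → α (w ℕ.+ m) w ≡ (+ 4) ^ atLeast2 m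
α-offset w {m} 1≤m = trans (α-< (ℕP.m<m+n w 1≤m)) (cong (λ e → (+ 4) ^ atLeast2 e) (ℕP.m+n∸m≡n w m))

β-α-below : ∀ W D → 1 ≤ D → let w = W ℕ.+ W ; k = w ℕ.+ (D ℕ.+ D) in
            β k w - + 2 * α k w ≡ - + 9 * ℕ𝟙.𝟙 w (k ∸ 2)
β-α-below W (suc zero) _ = begin
  β (w ℕ.+ 2) w - + 2 * α (w ℕ.+ 2) w  ≡⟨ cong₂ (λ b a → b - + 2 * a) (trans (β≡γ W 2) γ-2) (α-offset w (s≤s z≤n)) ⟩
  - + 9                                ≡⟨ ℤP.*-identityʳ (- + 9) ⟨
  - + 9 * 1ℤ                           ≡⟨ cong (- + 9 *_) (ℕ𝟙.𝟙-≡ (sym (ℕP.m+n∸n≡m w 2))) ⟨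
  - + 9 * ℕ𝟙.𝟙 w (w ℕ.+ 2 ∸ 2)         ∎
  where
  open ≡-Reasoning
  w = W ℕ.+ W
β-α-below W (suc (suc j)) _ = begin
  β k w - + 2 * α k w
    ≡⟨ cong₂ (λ b a → b - + 2 * a) (trans (β≡γ W m) (trans (cong γ m≡) (γ-even j))) (α-offset w {m} (s≤s z≤n)) ⟩
  0ℤ
    ≡⟨ ℤP.*-zeroʳ (- + 9) ⟨
  - + 9 * 0ℤ
    ≡⟨ cong (- + 9 *_) (ℕ𝟙.𝟙-≢ w≢k∸2) ⟨
  - + 9 * ℕ𝟙.𝟙 w (k ∸ 2) ∎
  where
  open ≡-Reasoning
  w = W ℕ.+ W
  m = suc (suc j) ℕ.+ suc (suc j)
  k = w ℕ.+ m
  m≡ : m ≡ 4 ℕ.+ (j ℕ.+ j)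
  m≡ = cong (λ n → 2 ℕ.+ n) (trans (ℕP.+-suc j (suc j)) (cong suc (ℕP.+-suc j j)))
  w≢k∸2 : w ≢ k ∸ 2
  w≢k∸2 w≡ = ℕP.<-irrefl (trans w≡ (ℕP.+-∸-assoc w {m} (s≤s (s≤s z≤n)))) (ℕP.m<m+n w {j ℕ.+ suc (suc j)} (ℕP.≤-trans (s≤s z≤n) (ℕP.m≤n+m (suc (suc j)) j)))

β-α-above : ∀ {k w} → 1 ≤ k → ¬ w < k → β k w - + 2 * α k w ≡ - + 9 * ℕ𝟙.𝟙 w (k ∸ 2)
β-α-above {k} {w} 1≤k w≮k = begin
  β k w - + 2 * α k w     ≡⟨ cong₂ (λ b a → b - + 2 * a) β≡0 (α-≮ w≮k) ⟩
  0ℤ                      ≡⟨ ℤP.*-zeroʳ (- + 9) ⟨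
  - + 9 * 0ℤ              ≡⟨ cong (- + 9 *_) (ℕ𝟙.𝟙-≢ w≢k∸2) ⟨
  - + 9 * ℕ𝟙.𝟙 w (k ∸ 2)  ∎
  where
  open ≡-Reasoning
  k∸2<k : ∀ {k} → 1 ≤ k → k ∸ 2 < k
  k∸2<k {suc k} _ = s≤s (ℕP.m∸n≤m k 1)
  w≢k∸2 : w ≢ k ∸ 2
  w≢k∸2 w≡ = w≮k (subst (_< k) (sym w≡) (k∸2<k 1≤k))
  β≡0 : β k w ≡ 0ℤ
  β≡0 = trans (∑-cong (oneTo k) (λ s → trans (cong (sg (w ℕ.+ s) * (+ 4) ^ atLeast2 s *_)
                  (α-≮ (λ w+s<k → w≮k (ℕP.≤-<-trans (ℕP.m≤m+n w s) w+s<k))))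
                (ℤP.*-zeroʳ (sg (w ℕ.+ s) * (+ 4) ^ atLeast2 s))))
              (∑-zero (oneTo k))

β-α-even : ∀ W K → let w = W ℕ.+ W ; k = 2 ℕ.* suc (suc K) in
           β k w - + 2 * α k w ≡ - + 9 * ℕ𝟙.𝟙 w (k ∸ 2)
β-α-even W K with W ℕ.<? suc (suc K)
... | yes W<K+2 = subst (λ k → β k w - + 2 * α k w ≡ - + 9 * ℕ𝟙.𝟙 w (k ∸ 2)) (sym k≡) (β-α-below W D 1≤D)
  where
  w = W ℕ.+ W
  D = suc (suc K) ∸ W
  W+D≡ : W ℕ.+ D ≡ suc (suc K)
  W+D≡ = ℕP.m+[n∸m]≡n (ℕP.<⇒≤ W<K+2)
  1≤D : 1 ≤ D
  1≤D = ℕP.m<n⇒0<n∸m W<K+2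
  double-+ : ∀ a b → 2 ℕ.* (a ℕ.+ b) ≡ (a ℕ.+ a) ℕ.+ (b ℕ.+ b)
  double-+ = ℕSolver.solve-∀
  k≡ : 2 ℕ.* suc (suc K) ≡ w ℕ.+ (D ℕ.+ D)
  k≡ = trans (cong (2 ℕ.*_) (sym W+D≡)) (double-+ W D)
... | no  W≮K+2 = β-α-above (s≤s z≤n) w≮k
  where
  w≮k : ¬ W ℕ.+ W < 2 ℕ.* suc (suc K)
  w≮k w<k = W≮K+2 (ℕP.*-cancelˡ-< 2 W (suc (suc K)) (subst (_< 2 ℕ.* suc (suc K)) (cong (W ℕ.+_) (sym (ℕP.+-identityʳ W))) w<k))

if-zero : ∀ b {x} → x ≡ 0ℤ → (if b then x else 0ℤ) ≡ 0ℤ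
if-zero true  x≡0 = x≡0
if-zero false _   = refl

if-*ʳ : ∀ b x y → (if b then x * y else 0ℤ) ≡ (if b then x else 0ℤ) * y
if-*ʳ true  x y = refl
if-*ʳ false x y = sym (ℤP.*-zeroˡ y)

∑-oneTo-from2-α : ∀ j → let k = 4 ℕ.+ (j ℕ.+ j) in
                  ∑[ s ∈ oneTo k ] (if 2 ℕ.≤ᵇ s then sg s * α k s else 0ℤ) ≡ + 3
∑-oneTo-from2-α j = begin
  ∑[ s ∈ oneTo k ] f s
    ≡⟨ ∑-oneTo-truncate k f (ℕP.n≤1+n (3 ℕ.+ x)) beyond ⟩
  sg (3 ℕ.+ x) * α k (3 ℕ.+ x) + ∑[ s ∈ oneTo (2 ℕ.+ x) ] f s
    ≡⟨ cong₂ _+_ top (∑-cong-∈ (oneTo (2 ℕ.+ x)) rest) ⟩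
  -1ℤ + ∑[ s ∈ oneTo (2 ℕ.+ x) ] ((if 2 ℕ.≤ᵇ s then sg s else 0ℤ) * + 4)
    ≡⟨ cong (_+_ -1ℤ) (trans (∑-*ʳ (oneTo (2 ℕ.+ x)) (λ s → if 2 ℕ.≤ᵇ s then sg s else 0ℤ) (+ 4)) (cong (_* + 4) (∑-oneTo-sg-from2 j))) ⟩
  + 3 ∎
  where
  open ≡-Reasoning
  x = j ℕ.+ j
  k = 4 ℕ.+ x
  f : ℕ → ℤ
  f s = if 2 ℕ.≤ᵇ s then sg s * α k s else 0ℤ
  beyond : ∀ {s} → 3 ℕ.+ x < s → f s ≡ 0ℤ
  beyond {s} k≤s = if-zero (2 ℕ.≤ᵇ s) (trans (cong (sg s *_) (α-≮ (ℕP.≤⇒≯ k≤s))) (ℤP.*-zeroʳ (sg s)))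
  top : sg (3 ℕ.+ x) * α k (3 ℕ.+ x) ≡ -1ℤ
  top = begin
    sg (3 ℕ.+ x) * α k (3 ℕ.+ x)
      ≡⟨ cong (sg (3 ℕ.+ x) *_) (α-< (ℕP.n<1+n (3 ℕ.+ x))) ⟩
    sg (3 ℕ.+ x) * (+ 4) ^ atLeast2 ((1 ℕ.+ x) ∸ x)
      ≡⟨ cong₂ (λ σ e → -1ℤ * (-1ℤ * (-1ℤ * σ)) * (+ 4) ^ atLeast2 e) (sg-double j) (ℕP.m+n∸n≡m 1 x) ⟩
    -1ℤ ∎
  rest : ∀ {s} → s ∈ oneTo (2 ℕ.+ x) → f s ≡ (if 2 ℕ.≤ᵇ s then sg s else 0ℤ) * + 4
  rest {s} s∈ = trans (cong (λ a → if 2 ℕ.≤ᵇ s then sg s * a else 0ℤ) α≡4) (if-*ʳ (2 ℕ.≤ᵇ s) (sg s) (+ 4))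
    where
    s<k : s < k
    s<k = ℕP.≤-trans (s≤s (proj₂ (∈-oneTo⁻ s∈))) (ℕP.n≤1+n (3 ℕ.+ x))
    α≡4 : α k s ≡ + 4
    α≡4 = trans (α-< s<k) (cong (λ e → (+ 4) ^ e)
      (atLeast2-≥2 (ℕP.m+n≤o⇒m≤o∸n 2 (ℕP.+-monoʳ-≤ 2 (proj₂ (∈-oneTo⁻ s∈))))))

imageCoeff-dual∘init-singleton : ∀ {k s} → 1 ≤ k → 1 ≤ s →
  imageCoeff k (dual ∘ init) (s ∷ []) ≡ (if 2 ℕ.≤ᵇ s then sg s * α k s else 0ℤ)
imageCoeff-dual∘init-singleton {k} {suc zero} _ _ = imageCoeff-dual∘init-nonadmissible k (λ { (_ , ()) })
imageCoeff-dual∘init-singleton {k} {s@(suc (suc _))} 1≤k _ = begin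
  imageCoeff k (dual ∘ init) q
    ≡⟨ imageCoeff-dual∘init k q-adm ⟩
  imageCoeff k init (dual q)
    ≡⟨ imageCoeff-init-nonempty 1≤k (dual-admissible q) (dual-nonempty q-adm (λ ())) ⟩
  -1ℤ * c (dual q) * α k (weight (dual q))
    ≡⟨ cong₂ (λ γ v → -1ℤ * γ * α k v) (c-dual q-adm) (weight-dual q q-adm) ⟩
  -1ℤ * (sg (s ℕ.+ 0) * c q) * α k (s ℕ.+ 0)
    ≡⟨ cong₂ (λ v γ → -1ℤ * (sg v * γ) * α k v) (ℕP.+-identityʳ s) (c-singleton s (s≤s (s≤s z≤n))) ⟩
  -1ℤ * (sg s * -1ℤ) * α k s
    ≡⟨ cancel (sg s) (α k s) ⟩
  sg s * α k s ∎
  where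
  open ≡-Reasoning
  q = s ∷ []
  q-adm = [ s ]-admissible (s≤s (s≤s z≤n))
  cancel : ∀ σ a → -1ℤ * (σ * -1ℤ) * a ≡ σ * a
  cancel = solve-∀

imageCoeff-init∘dual∘init-[] : ∀ j → imageCoeff (4 ℕ.+ (j ℕ.+ j)) (init ∘ dual ∘ init) [] ≡ + 2
imageCoeff-init∘dual∘init-[] j = begin
  imageCoeff k (init ∘ dual ∘ init) []
    ≡⟨ imageCoeff-init∘dual∘init k [] ⟩
  𝟙 [] [] * imageCoeff k init [] + ∑[ s ∈ oneTo k ] imageCoeff k (dual ∘ init) (s ∷ [])
    ≡⟨ cong₂ _+_ (cong₂ _*_ (𝟙-≡ {[]} refl) (imageCoeff-init-[] {k} (s≤s (s≤s z≤n))))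
                 (∑-cong-∈ (oneTo k) (λ s∈ → imageCoeff-dual∘init-singleton (s≤s z≤n) (proj₁ (∈-oneTo⁻ s∈)))) ⟩
  1ℤ * -1ℤ + ∑[ s ∈ oneTo k ] (if 2 ℕ.≤ᵇ s then sg s * α k s else 0ℤ)
    ≡⟨ cong (_+_ (1ℤ * -1ℤ)) (∑-oneTo-from2-α j) ⟩
  + 2 ∎
  where
  open ≡-Reasoning
  k = 4 ℕ.+ (j ℕ.+ j)

P : ℕ → Composition → ℤ
P k y = imageCoeff k init y + imageCoeff k mid y + imageCoeff k fin y

Q : ℕ → Composition → ℤ
Q k y = - + 9 * imageCoeff (k ∸ 2) id y

P-via-init : ∀ n {y} → Admissible y → let k = 2 ℕ.* n in
             P k y ≡ imageCoeff k init y + imageCoeff k (init ∘ dual ∘ init) y + imageCoeff k init (dual y)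
P-via-init n {y} y-adm = cong₂ (λ m f → imageCoeff (2 ℕ.* n) init y + m + f) (imageCoeff-mid n y) (imageCoeff-fin n y-adm)

parity : ∀ n → ∃[ W ] (n ≡ W ℕ.+ W ⊎ n ≡ suc (W ℕ.+ W))
parity zero    = 0 , inj₁ refl
parity (suc n) with parity n
... | W , inj₁ n≡ = W , inj₂ (cong suc n≡)
... | W , inj₂ n≡ = suc W , inj₁ (cong suc (trans n≡ (sym (ℕP.+-suc W W))))

-- For odd w both sides below vanish, since then sg w ≡ -1.
β-α-symmetric : ∀ K w → let k = 2 ℕ.* suc (suc K) in
  (1ℤ + sg w) * (β k w - + 2 * α k w) ≡ (1ℤ + sg w) * (- + 9 * ℕ𝟙.𝟙 w (k ∸ 2))
β-α-symmetric K w with parity w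
... | W , inj₁ refl = cong ((1ℤ + sg (W ℕ.+ W)) *_) (β-α-even W K)
... | W , inj₂ refl = trans (vanish (sg-double W)) (sym (vanish (sg-double W)))
  where
  vanish : ∀ {σ x} → σ ≡ 1ℤ → (1ℤ + -1ℤ * σ) * x ≡ 0ℤ
  vanish {x = x} refl = ℤP.*-zeroˡ x

P-symmetric-[] : ∀ K → let k = 2 ℕ.* suc (suc K) in P k [] + P k [] ≡ Q k [] + Q k []
P-symmetric-[] K = begin
  P k [] + P k []  ≡⟨ cong (λ p → p + p) (trans (P-via-init (suc (suc K)) ([] , refl)) values) ⟩
  0ℤ + 0ℤ          ≡⟨ cong (λ q → q + q) Q[]≡0 ⟨
  Q k [] + Q k []  ∎
  where
  open ≡-Reasoning
  k = 2 ℕ.* suc (suc K)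
  4≤k : 4 ≤ k
  4≤k = ℕP.*-monoʳ-≤ 2 (s≤s (s≤s z≤n))
  values : imageCoeff k init [] + imageCoeff k (init ∘ dual ∘ init) [] + imageCoeff k init [] ≡ 0ℤ
  values = cong₂ (λ i m → i + m + i) (imageCoeff-init-[] (ℕP.≤-trans (s≤s (s≤s z≤n)) 4≤k))
    (subst (λ k → imageCoeff k (init ∘ dual ∘ init) [] ≡ + 2) (sym k≡) (imageCoeff-init∘dual∘init-[] K))
    where
    k≡ : k ≡ 4 ℕ.+ (K ℕ.+ K)
    k≡ = cong (λ n → 2 ℕ.+ n) (trans (cong (K ℕ.+_) (ℕP.+-identityʳ (suc (suc K)))) (trans (ℕP.+-suc K (suc K)) (cong suc (ℕP.+-suc K K))))
  Q[]≡0 : Q k [] ≡ 0ℤ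
  Q[]≡0 = begin
    - + 9 * imageCoeff (k ∸ 2) id []
      ≡⟨ cong (- + 9 *_) (imageCoeff-id (k ∸ 2) ([] , refl)) ⟩
    - + 9 * (ℕ𝟙.𝟙 0 (k ∸ 2) * 1ℤ)
      ≡⟨ cong (λ e → - + 9 * (e * 1ℤ)) (ℕ𝟙.𝟙-≢ (λ 0≡k∸2 → ℕP.<-irrefl 0≡k∸2 (ℕP.≤-trans (s≤s z≤n) (ℕP.m+n≤o⇒m≤o∸n 2 4≤k)))) ⟩
    0ℤ ∎
P-symmetric-nonempty : ∀ K {y} → Admissible y → y ≢ [] → let k = 2 ℕ.* suc (suc K) in
                       P k y + P k (dual y) ≡ Q k y + Q k (dual y)
P-symmetric-nonempty K {y} y-adm y≢[] = begin
  P k y + P k ȳ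
    ≡⟨ cong₂ _+_ (P-via-init (suc (suc K)) y-adm)
                 (trans (P-via-init (suc (suc K)) ȳ-adm) (cong (λ z → I ȳ + M ȳ + I z) (dual-involutive y y-adm))) ⟩
  (I y + M y + I ȳ) + (I ȳ + M ȳ + I y)
    ≡⟨ cong₂ _+_ (cong₂ _+_ (cong₂ _+_ Iy My) Iȳ) (cong₂ _+_ (cong₂ _+_ Iȳ Mȳ) Iy) ⟩
  (-1ℤ * C * αw + C * βw + -1ℤ * (σ * C) * αw) + (-1ℤ * (σ * C) * αw + σ * C * βw + -1ℤ * C * αw)
    ≡⟨ lhs-shape C σ αw βw ⟩
  C * ((1ℤ + σ) * (βw - + 2 * αw))
    ≡⟨ cong (C *_) (β-α-symmetric K w) ⟩
  C * ((1ℤ + σ) * (- + 9 * E))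
    ≡⟨ rhs-shape C σ E ⟨
  - + 9 * (E * C) + - + 9 * (E * (σ * C))
    ≡⟨ cong₂ (λ q q̄ → - + 9 * q + - + 9 * q̄) (imageCoeff-id (k ∸ 2) y-adm) Qȳ ⟨
  Q k y + Q k ȳ ∎
  where
  open ≡-Reasoning
  k = 2 ℕ.* suc (suc K)
  ȳ = dual y
  ȳ-adm = dual-admissible y
  I M : Composition → ℤ
  I = imageCoeff k init
  M = imageCoeff k (init ∘ dual ∘ init)
  w = weight y
  C = c y
  σ = sg w
  αw = α k w
  βw = β k w
  E = ℕ𝟙.𝟙 w (k ∸ 2)
  ȳ≢[] = dual-nonempty y-adm y≢[]
  1≤k : 1 ≤ k
  1≤k = s≤s z≤n
  Iy : I y ≡ -1ℤ * C * αw
  Iy = imageCoeff-init-nonempty 1≤k y-adm y≢[]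
  Iȳ : I ȳ ≡ -1ℤ * (σ * C) * αw
  Iȳ = trans (imageCoeff-init-nonempty 1≤k ȳ-adm ȳ≢[]) (cong₂ (λ γ v → -1ℤ * γ * α k v) (c-dual y-adm) (weight-dual y y-adm))
  My : M y ≡ C * βw
  My = imageCoeff-init∘dual∘init-nonempty 1≤k y-adm y≢[]
  Mȳ : M ȳ ≡ σ * C * βw
  Mȳ = trans (imageCoeff-init∘dual∘init-nonempty 1≤k ȳ-adm ȳ≢[]) (cong₂ (λ γ v → γ * β k v) (c-dual y-adm) (weight-dual y y-adm))
  Qȳ : imageCoeff (k ∸ 2) id ȳ ≡ E * (σ * C)
  Qȳ = trans (imageCoeff-id (k ∸ 2) ȳ-adm) (cong₂ (λ v γ → ℕ𝟙.𝟙 v (k ∸ 2) * γ) (weight-dual y y-adm) (c-dual y-adm))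
  lhs-shape : ∀ C σ αw βw → (-1ℤ * C * αw + C * βw + -1ℤ * (σ * C) * αw) + (-1ℤ * (σ * C) * αw + σ * C * βw + -1ℤ * C * αw) ≡
                          C * ((1ℤ + σ) * (βw - + 2 * αw))
  lhs-shape = solve-∀
  rhs-shape : ∀ C σ E → - + 9 * (E * C) + - + 9 * (E * (σ * C)) ≡ C * ((1ℤ + σ) * (- + 9 * E))
  rhs-shape = solve-∀

P-symmetric : ∀ K {y} → Admissible y → let k = 2 ℕ.* suc (suc K) in
              P k y + P k (dual y) ≡ Q k y + Q k (dual y)
P-symmetric K {[]}    _     = P-symmetric-[] K
P-symmetric K {_ ∷ _} y-adm = P-symmetric-nonempty K y-adm (λ ())

module _ {m : ℕ} {ψ : Composition → ℤ} (ψ-support : ∀ {z} → Admissible z → ψ z ≢ 0ℤ → weight z ≡ m) where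

  ψ-expand : ∀ {z} → Admissible z → ψ z ≡ ∑[ y ∈ 𝒜 m ] (𝟙 z y * ψ y)
  ψ-expand {z} z-adm with weight z ℕ.≟ m
  ... | yes weight≡m = sym (∑-𝟙-admissibleOfWeight m ψ (z-adm , weight≡m))
  ... | no  weight≢m with ψ z ℤ.≟ 0ℤ
  ...   | yes ψz≡0 = trans ψz≡0 (sym (∑-𝟙-admissibleOfWeight-∉ m {z} ψ (weight≢m ∘ proj₂)))
  ...   | no  ψz≢0 = ⊥-elim (weight≢m (ψ-support z-adm ψz≢0))

  ∑-c-ψ∘ : ∀ k g → (∀ {a} → a ∈ 𝒜 k → Admissible (g a)) →
           ∑[ a ∈ 𝒜 k ] (c a * ψ (g a)) ≡ ∑[ y ∈ 𝒜 m ] (ψ y * imageCoeff k g y)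
  ∑-c-ψ∘ k g g-adm = begin
    ∑[ a ∈ 𝒜 k ] (c a * ψ (g a))
      ≡⟨ ∑-cong-∈ (𝒜 k) (λ {a} a∈ → trans (cong (c a *_) (ψ-expand (g-adm a∈))) (sym (∑-*ˡ (𝒜 m) (c a) _))) ⟩
    ∑[ a ∈ 𝒜 k ] ∑[ y ∈ 𝒜 m ] (c a * (𝟙 (g a) y * ψ y))
      ≡⟨ ∑-comm (𝒜 k) (𝒜 m) _ ⟩
    ∑[ y ∈ 𝒜 m ] ∑[ a ∈ 𝒜 k ] (c a * (𝟙 (g a) y * ψ y))
      ≡⟨ ∑-cong (𝒜 m) (λ y → trans (∑-cong (𝒜 k) (λ a → reorder (c a) (𝟙 (g a) y) (ψ y))) (∑-*ˡ (𝒜 k) (ψ y) _)) ⟩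
    ∑[ y ∈ 𝒜 m ] (ψ y * imageCoeff k g y) ∎
    where
    open ≡-Reasoning
    reorder : ∀ γ e p → γ * (e * p) ≡ p * (γ * e)
    reorder = solve-∀

  module _ (ψ-dual : ∀ {z} → Admissible z → ψ z ≡ ψ (dual z)) where

    ∑-ψ-dual : ∀ (F : Composition → ℤ) → ∑[ y ∈ 𝒜 m ] (ψ y * F y) ≡ ∑[ y ∈ 𝒜 m ] (ψ y * F (dual y))
    ∑-ψ-dual F = begin
      ∑[ y ∈ 𝒜 m ] (ψ y * F y)
        ≡⟨ ∑-admissibleOfWeight-dual m (λ y → ψ y * F y) ⟨
      ∑[ y ∈ 𝒜 m ] (ψ (dual y) * F (dual y))
        ≡⟨ ∑-cong-∈ (𝒜 m) (λ {y} y∈ → cong (_* F (dual y)) (sym (ψ-dual (proj₁ (∈-admissibleOfWeight⁻ m y∈))))) ⟩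
      ∑[ y ∈ 𝒜 m ] (ψ y * F (dual y)) ∎
      where open ≡-Reasoning

    -- Double each side and reindex one copy by duality.
    ∑-ψ-cong-symmetrized : ∀ (F G : Composition → ℤ) → (∀ {y} → Admissible y → F y + F (dual y) ≡ G y + G (dual y)) →
                           ∑[ y ∈ 𝒜 m ] (ψ y * F y) ≡ ∑[ y ∈ 𝒜 m ] (ψ y * G y)
    ∑-ψ-cong-symmetrized F G F≈G = ℤP.*-cancelˡ-≡ (+ 2) _ _ (begin
      + 2 * ∑[ y ∈ 𝒜 m ] (ψ y * F y)                               ≡⟨ double _ ⟩
      ∑[ y ∈ 𝒜 m ] (ψ y * F y) + ∑[ y ∈ 𝒜 m ] (ψ y * F y)          ≡⟨ cong (_+_ (∑[ y ∈ 𝒜 m ] (ψ y * F y))) (∑-ψ-dual F) ⟩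
      ∑[ y ∈ 𝒜 m ] (ψ y * F y) + ∑[ y ∈ 𝒜 m ] (ψ y * F (dual y))   ≡⟨ ∑-+ (𝒜 m) _ _ ⟨
      ∑[ y ∈ 𝒜 m ] (ψ y * F y + ψ y * F (dual y))                  ≡⟨ ∑-cong-∈ (𝒜 m) symmetrized ⟩
      ∑[ y ∈ 𝒜 m ] (ψ y * G y + ψ y * G (dual y))                  ≡⟨ ∑-+ (𝒜 m) _ _ ⟩
      ∑[ y ∈ 𝒜 m ] (ψ y * G y) + ∑[ y ∈ 𝒜 m ] (ψ y * G (dual y))   ≡⟨ cong (_+_ (∑[ y ∈ 𝒜 m ] (ψ y * G y))) (∑-ψ-dual G) ⟨
      ∑[ y ∈ 𝒜 m ] (ψ y * G y) + ∑[ y ∈ 𝒜 m ] (ψ y * G y)          ≡⟨ double _ ⟨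
      + 2 * ∑[ y ∈ 𝒜 m ] (ψ y * G y)                               ∎)
      where
      open ≡-Reasoning
      double : ∀ x → + 2 * x ≡ x + x
      double = solve-∀
      symmetrized : ∀ {y} → y ∈ 𝒜 m → ψ y * F y + ψ y * F (dual y) ≡ ψ y * G y + ψ y * G (dual y)
      symmetrized {y} y∈ = begin
        ψ y * F y + ψ y * F (dual y)   ≡⟨ ℤP.*-distribˡ-+ (ψ y) (F y) _ ⟨
        ψ y * (F y + F (dual y))       ≡⟨ cong (ψ y *_) (F≈G (proj₁ (∈-admissibleOfWeight⁻ m y∈))) ⟩
        ψ y * (G y + G (dual y))       ≡⟨ ℤP.*-distribˡ-+ (ψ y) (G y) _ ⟩
        ψ y * G y + ψ y * G (dual y)   ∎

    ∑-c-ψ-recursion : ∀ K → let k = 2 ℕ.* suc (suc K) in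
      ∑[ a ∈ 𝒜 k ] (c a * (ψ (init a) + ψ (mid a) + ψ (fin a))) ≡ - + 9 * ∑[ a ∈ 𝒜 (k ∸ 2) ] (c a * ψ a)
    ∑-c-ψ-recursion K = begin
      ∑[ a ∈ 𝒜 k ] (c a * (ψ (init a) + ψ (mid a) + ψ (fin a)))
        ≡⟨ ∑-cong (𝒜 k) (λ a → distrib (c a) (ψ (init a)) (ψ (mid a)) (ψ (fin a))) ⟩
      ∑[ a ∈ 𝒜 k ] (c a * ψ (init a) + c a * ψ (mid a) + c a * ψ (fin a))
        ≡⟨ trans (∑-+ (𝒜 k) _ _) (cong (_+ ∑[ a ∈ 𝒜 k ] (c a * ψ (fin a))) (∑-+ (𝒜 k) _ _)) ⟩
      ∑[ a ∈ 𝒜 k ] (c a * ψ (init a)) + ∑[ a ∈ 𝒜 k ] (c a * ψ (mid a)) + ∑[ a ∈ 𝒜 k ] (c a * ψ (fin a))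
        ≡⟨ cong₂ _+_ (cong₂ _+_ (∑-c-ψ∘ k init (init-admissible ∘ admissible k)) (∑-c-ψ∘ k mid (λ {a} _ → mid-admissible a)))
                     (∑-c-ψ∘ k fin (λ {a} _ → fin-admissible a)) ⟩
      ∑[ y ∈ 𝒜 m ] (ψ y * imageCoeff k init y) + ∑[ y ∈ 𝒜 m ] (ψ y * imageCoeff k mid y) + ∑[ y ∈ 𝒜 m ] (ψ y * imageCoeff k fin y)
        ≡⟨ trans (∑-+ (𝒜 m) _ (λ y → ψ y * imageCoeff k fin y)) (cong (_+ ∑[ y ∈ 𝒜 m ] (ψ y * imageCoeff k fin y)) (∑-+ (𝒜 m) _ _)) ⟨
      ∑[ y ∈ 𝒜 m ] (ψ y * imageCoeff k init y + ψ y * imageCoeff k mid y + ψ y * imageCoeff k fin y)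
        ≡⟨ ∑-cong (𝒜 m) (λ y → sym (distrib (ψ y) _ _ _)) ⟩
      ∑[ y ∈ 𝒜 m ] (ψ y * P k y)
        ≡⟨ ∑-ψ-cong-symmetrized (P k) (Q k) (P-symmetric K) ⟩
      ∑[ y ∈ 𝒜 m ] (ψ y * (- + 9 * imageCoeff (k ∸ 2) id y))
        ≡⟨ ∑-cong (𝒜 m) (λ y → reorder (ψ y) (imageCoeff (k ∸ 2) id y)) ⟩
      ∑[ y ∈ 𝒜 m ] (- + 9 * (ψ y * imageCoeff (k ∸ 2) id y))
        ≡⟨ ∑-*ˡ (𝒜 m) (- + 9) _ ⟩
      - + 9 * ∑[ y ∈ 𝒜 m ] (ψ y * imageCoeff (k ∸ 2) id y)
        ≡⟨ cong (- + 9 *_) (∑-c-ψ∘ (k ∸ 2) id (admissible (k ∸ 2))) ⟨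
      - + 9 * ∑[ a ∈ 𝒜 (k ∸ 2) ] (c a * ψ a) ∎
      where
      open ≡-Reasoning
      k = 2 ℕ.* suc (suc K)
      admissible : ∀ n {a} → a ∈ 𝒜 n → Admissible a
      admissible n = proj₁ ∘ ∈-admissibleOfWeight⁻ n
      distrib : ∀ x p q r → x * (p + q + r) ≡ x * p + x * q + x * r
      distrib = solve-∀
      reorder : ∀ p i → p * (- + 9 * i) ≡ - + 9 * (p * i)
      reorder = solve-∀

SupportedIn : ℕ → FormalSum → Set
SupportedIn k X = ∀ {b} → coeff X b ≢ 0ℤ → AdmissibleOfWeight k b

coeff≡coeff-initL : ∀ {k} X {b} → 1 ≤ k → SupportedIn k X → AdmissibleOfWeight k b → coeff X b ≡ coeff (initL X) (init b)
coeff≡coeff-initL {k} X {b} 1≤k X-supp b-adm = begin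
  coeff X b
    ≡⟨ coeff-⟨⟩ X b ⟩
  ⟨ X , (λ a → 𝟙 a b) ⟩
    ≡⟨ ⟨⟩-cong-support X (λ a Xa≢0 → 𝟙-cong-⇔ (mk⇔ (cong init) (init-injective 1≤k (X-supp Xa≢0) b-adm))) ⟩
  ⟨ X , (λ a → 𝟙 (init a) (init b)) ⟩
    ≡⟨ coeff-initL X (init b) ⟨
  coeff (initL X) (init b) ∎
  where open ≡-Reasoning

≈-via-initL : ∀ {k} X Y → 1 ≤ k → SupportedIn k X → SupportedIn k Y →
              (∀ {b} → AdmissibleOfWeight k b → coeff (initL X) (init b) ≡ coeff (initL Y) (init b)) → X ≈ Y
≈-via-initL {k} X Y 1≤k X-supp Y-supp initL≡ b = by-cases (coeff X b ℤ.≟ 0ℤ) (coeff Y b ℤ.≟ 0ℤ)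
  where
  agree : AdmissibleOfWeight k b → coeff X b ≡ coeff Y b
  agree b-adm = trans (coeff≡coeff-initL X 1≤k X-supp b-adm) (trans (initL≡ b-adm) (sym (coeff≡coeff-initL Y 1≤k Y-supp b-adm)))
  by-cases : Dec (coeff X b ≡ 0ℤ) → Dec (coeff Y b ≡ 0ℤ) → coeff X b ≡ coeff Y b
  by-cases (yes Xb≡0) (yes Yb≡0) = trans Xb≡0 (sym Yb≡0)
  by-cases (no  Xb≢0) _          = agree (X-supp Xb≢0)
  by-cases (yes _)    (no  Yb≢0) = agree (Y-supp Yb≢0)

κ : ℕ → ℤ
κ r = -1ℤ ^ r * (+ 3) ^ (2 ℕ.* r ∸ 1)

κ-step : ∀ n → κ (suc (suc n)) ≡ - + 9 * κ (suc n)
κ-step n = begin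
  -1ℤ ^ (2 ℕ.+ n) * (+ 3) ^ (2 ℕ.* suc (suc n) ∸ 1)     ≡⟨ cong (λ e → -1ℤ ^ (2 ℕ.+ n) * (+ 3) ^ e) exponent ⟩
  -1ℤ ^ (2 ℕ.+ n) * (+ 3) ^ (2 ℕ.+ (2 ℕ.* suc n ∸ 1))   ≡⟨ reassoc (-1ℤ ^ n) ((+ 3) ^ (2 ℕ.* suc n ∸ 1)) ⟩
  - + 9 * κ (suc n)                                    ∎
  where
  open ≡-Reasoning
  exponent : 2 ℕ.* suc (suc n) ∸ 1 ≡ 2 ℕ.+ (2 ℕ.* suc n ∸ 1)
  exponent = trans (cong (_∸ 1) (ℕP.*-suc 2 (suc n))) (ℕP.+-∸-assoc 2 (ℕP.≤-trans (s≤s z≤n) (ℕP.≤-reflexive (sym (ℕP.*-suc 2 n)))))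
  reassoc : ∀ σ t → -1ℤ * (-1ℤ * σ) * (+ 3 * (+ 3 * t)) ≡ - + 9 * (-1ℤ * σ * t)
  reassoc = solve-∀

init-replicate : ∀ n (x : ℕ) → init (replicate (suc n) x) ≡ replicate n x
init-replicate zero    x = refl
init-replicate (suc n) x = cong (x ∷_) (init-replicate n x)

replicate-2-admissibleOfWeight : ∀ n → AdmissibleOfWeight (2 ℕ.* suc n) (replicate (suc n) 2)
replicate-2-admissibleOfWeight n = (entries (suc n) , refl) , weight-replicate (suc n)
  where
  entries : ∀ r → IsComposition (replicate r 2)
  entries zero    = []
  entries (suc r) = s≤s z≤n ∷ entries r
  weight-replicate : ∀ r → weight (replicate r 2) ≡ 2 ℕ.* r
  weight-replicate zero    = refl
  weight-replicate (suc r) = trans (cong (2 ℕ.+_) (weight-replicate r)) (sym (ℕP.*-suc 2 r))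

⟨theSum⟩ : ∀ r φ → ⟨ theSum r , φ ⟩ ≡ ∑[ a ∈ 𝒜 (2 ℕ.* r) ] (c a * φ a)
⟨theSum⟩ r φ = ∑-map _ (𝒜 (2 ℕ.* r)) _

coeff-initL-⊙-single : ∀ e a x → coeff (initL (e ⊙ single a)) x ≡ e * 𝟙 (init a) x
coeff-initL-⊙-single e a x =
  trans (coeff-initL (e ⊙ single a) x) (trans (⟨⟩-⊙ e (single a) (λ b → 𝟙 (init b) x)) (cong (e *_) (⟨⟩-single a (λ b → 𝟙 (init b) x))))

module _ (D : Composition → FormalSum) (D-delta : IsDelta D) where
  open IsDelta D-delta

  image target : ℕ → FormalSum
  image r  = linExt D (theSum r)
  target r = κ r ⊙ single (replicate r 2)

  coeff-image : ∀ r z → coeff (image r) z ≡ ∑[ a ∈ 𝒜 (2 ℕ.* r) ] (c a * coeff (D a) z)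
  coeff-image r z = trans (coeff-linExt D (theSum r) z) (⟨theSum⟩ r (λ a → coeff (D a) z))

  coeff-initL-image : ∀ r x → coeff (initL (image r)) x ≡ ∑[ a ∈ 𝒜 (2 ℕ.* r) ] (c a * coeff (initL (D a)) x)
  coeff-initL-image r x = begin
    coeff (initL (image r)) x
      ≡⟨ coeff-initL (image r) x ⟩
    ⟨ image r , (λ a → 𝟙 (init a) x) ⟩
      ≡⟨ ⟨⟩-linExt D (theSum r) _ ⟩
    ⟨ theSum r , (λ a → ⟨ D a , (λ b → 𝟙 (init b) x) ⟩) ⟩
      ≡⟨ ⟨theSum⟩ r _ ⟩
    ∑[ a ∈ 𝒜 (2 ℕ.* r) ] (c a * ⟨ D a , (λ b → 𝟙 (init b) x) ⟩)
      ≡⟨ ∑-cong (𝒜 (2 ℕ.* r)) (λ a → cong (c a *_) (sym (coeff-initL (D a) x))) ⟩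
    ∑[ a ∈ 𝒜 (2 ℕ.* r) ] (c a * coeff (initL (D a)) x) ∎
    where open ≡-Reasoning

  image-supported : ∀ r → SupportedIn (2 ℕ.* r) (image r)
  image-supported r {z} image-z≢0
    with a , a∈ , term≢0 ← ∑≢0⇒∃ (𝒜 (2 ℕ.* r)) _ (image-z≢0 ∘ trans (coeff-image r z))
    with (a-adm , weight≡) ← ∈-admissibleOfWeight⁻ (2 ℕ.* r) a∈
    with z-adm , weight-z≡ ← homog a z a-adm (λ Da-z≡0 → term≢0 (trans (cong (c a *_) Da-z≡0) (ℤP.*-zeroʳ (c a))))
    = z-adm , trans weight-z≡ weight≡

  target-supported : ∀ n → SupportedIn (2 ℕ.* suc n) (target (suc n))
  target-supported n {z} target-z≢0 = by-cases (replicate (suc n) 2 ≟ᶜ z)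
    where
    by-cases : Dec (replicate (suc n) 2 ≡ z) → AdmissibleOfWeight (2 ℕ.* suc n) z
    by-cases (yes refl) = replicate-2-admissibleOfWeight n
    by-cases (no  ≢z)   = ⊥-elim (target-z≢0 (begin
      coeff (target (suc n)) z                      ≡⟨ coeff-⊙-single (κ (suc n)) (replicate (suc n) 2) z ⟩
      κ (suc n) * 𝟙 (replicate (suc n) 2) z         ≡⟨ cong (κ (suc n) *_) (𝟙-≢ ≢z) ⟩
      κ (suc n) * 0ℤ                                ≡⟨ ℤP.*-zeroʳ (κ (suc n)) ⟩
      0ℤ                                            ∎))
      where open ≡-Reasoning

  coeff-initL-D : ∀ {a} x → Admissible a → a ≢ [] →
                  coeff (initL (D a)) x ≡ coeff (D (init a)) x + coeff (D (mid a)) x + coeff (D (fin a)) x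
  coeff-initL-D {[]}     x _     a≢[] = ⊥-elim (a≢[] refl)
  coeff-initL-D {y ∷ ys} x a-adm _    = trans (rec y ys a-adm x)
    (trans (coeff-++ (D (init a) ⊕ D (mid a)) (D (fin a)) x) (cong (_+ coeff (D (fin a)) x) (coeff-++ (D (init a)) (D (mid a)) x)))
    where a = y ∷ ys

  ψ : Composition → Composition → ℤ
  ψ x z = coeff (D z) x

  ψ-support : ∀ x {z} → Admissible z → ψ x z ≢ 0ℤ → weight z ≡ weight x
  ψ-support x z-adm ψz≢0 = sym (proj₂ (homog _ x z-adm ψz≢0))

  ψ-dual : ∀ x {z} → Admissible z → ψ x z ≡ ψ x (dual z)
  ψ-dual x z-adm = classInv _ z-adm x

  coeff-initL-image-ψ : ∀ n x → coeff (initL (image (suc n))) x ≡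
                        ∑[ a ∈ 𝒜 (2 ℕ.* suc n) ] (c a * (ψ x (init a) + ψ x (mid a) + ψ x (fin a)))
  coeff-initL-image-ψ n x = trans (coeff-initL-image (suc n) x) (∑-cong-∈ (𝒜 (2 ℕ.* suc n)) (λ {a} a∈ → cong (c a *_) (split a∈)))
    where
    split : ∀ {a} → a ∈ 𝒜 (2 ℕ.* suc n) → coeff (initL (D a)) x ≡ ψ x (init a) + ψ x (mid a) + ψ x (fin a)
    split a∈ with a∈𝒜 ← ∈-admissibleOfWeight⁻ (2 ℕ.* suc n) a∈ =
      coeff-initL-D x (proj₁ a∈𝒜) (admissibleOfWeight-nonempty (s≤s z≤n) a∈𝒜)

  initL-image≡initL-target-1 : ∀ x → coeff (initL (image 1)) x ≡ coeff (initL (target 1)) x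
  initL-image≡initL-target-1 x = begin
    coeff (initL (image 1)) x
      ≡⟨ coeff-initL-image-ψ 0 x ⟩
    -1ℤ * (ψ x [] + ψ x [] + ψ x []) + 0ℤ
      ≡⟨ cong (λ u → -1ℤ * (u + u + u) + 0ℤ) (trans (empty x) (ℤP.+-identityʳ (𝟙 [] x))) ⟩
    -1ℤ * (u + u + u) + 0ℤ
      ≡⟨ triple u ⟩
    - + 3 * u
      ≡⟨ coeff-initL-⊙-single (κ 1) (2 ∷ []) x ⟨
    coeff (initL (target 1)) x ∎
    where
    open ≡-Reasoning
    u = 𝟙 [] x
    triple : ∀ u → -1ℤ * (u + u + u) + 0ℤ ≡ - + 3 * u
    triple = solve-∀

  image≈target : ∀ n → image (suc n) ≈ target (suc n)
  initL-image≡initL-target : ∀ n x → coeff (initL (image (suc n))) x ≡ coeff (initL (target (suc n))) x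

  image≈target n = ≈-via-initL (image (suc n)) (target (suc n)) (s≤s z≤n) (image-supported (suc n)) (target-supported n)
                               (λ {b} _ → initL-image≡initL-target n (init b))

  initL-image≡initL-target zero    x = initL-image≡initL-target-1 x
  initL-image≡initL-target (suc n) x = begin
    coeff (initL (image (2 ℕ.+ n))) x
      ≡⟨ coeff-initL-image-ψ (suc n) x ⟩
    ∑[ a ∈ 𝒜 (2 ℕ.* suc (suc n)) ] (c a * (ψ x (init a) + ψ x (mid a) + ψ x (fin a)))
      ≡⟨ ∑-c-ψ-recursion (ψ-support x) (ψ-dual x) n ⟩
    - + 9 * ∑[ a ∈ 𝒜 (2 ℕ.* suc (suc n) ∸ 2) ] (c a * ψ x a)
      ≡⟨ cong (λ k → - + 9 * ∑[ a ∈ 𝒜 k ] (c a * ψ x a)) (trans (cong (_∸ 2) (ℕP.*-suc 2 (suc n))) (ℕP.m+n∸m≡n 2 (2 ℕ.* suc n))) ⟩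
    - + 9 * ∑[ a ∈ 𝒜 (2 ℕ.* suc n) ] (c a * ψ x a)
      ≡⟨ cong (- + 9 *_) (trans (sym (coeff-image (suc n) x)) (image≈target n x)) ⟩
    - + 9 * coeff (target (suc n)) x
      ≡⟨ cong (- + 9 *_) (coeff-⊙-single (κ (suc n)) (replicate (suc n) 2) x) ⟩
    - + 9 * (κ (suc n) * 𝟙 (replicate (suc n) 2) x)
      ≡⟨ ℤP.*-assoc (- + 9) (κ (suc n)) _ ⟨
    - + 9 * κ (suc n) * 𝟙 (replicate (suc n) 2) x
      ≡⟨ cong₂ (λ e r → e * 𝟙 r x) (κ-step n) (init-replicate (suc n) 2) ⟨
    κ (2 ℕ.+ n) * 𝟙 (init (replicate (2 ℕ.+ n) 2)) x
      ≡⟨ coeff-initL-⊙-single (κ (2 ℕ.+ n)) (replicate (2 ℕ.+ n) 2) x ⟨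
    coeff (initL (target (2 ℕ.+ n))) x ∎
    where open ≡-Reasoning

theorem22 : (D : Composition → FormalSum) → IsDelta D →
    (r : ℕ) → 1 ≤ r →
    linExt D (theSum r) ≈ ((- + 1) ^ r * (+ 3) ^ (2 ℕ.* r ∸ 1)) ⊙ single (replicate r 2)
theorem22 D D-delta (suc n) _ = image≈target D D-delta n
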